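{- Let $G$ be a simple connected graph on $[n]$ such that its Laplacian simplex $\mathcal{P}_G$ is reflexive. Let $\mathcal{W}(G)$ be the whiskered graph on $[2n]$ and $L\in\mathbb{Z}^{2n\times 2n}$ its Laplacian matrix, and let $L(n)$ denote $L$ with its $n$-th column deleted. Then the set of lattice points in the fundamental parallelepiped of the simplex $\mathrm{conv}(\text{rows of } L(n))$ equals \[ \left\{(\lambda,\lambda)\cdot[L(n)\mid\mathbb{1}],\ \left((\lambda,\lambda)+\tfrac{1}{2n}\mathbb{1}\right)\cdot[L(n)\mid\mathbb{1}]\;\middle|\;\lambda\in\Lambda(\mathcal{P}_G)\right\}. \]
   Context: The Laplacian matrix $L$ of a simple graph on $[m]$ has $L_{ii}=\deg(i)$, $L_{ij}=-1$ if $\{i,j\}$ is an edge and $0$ otherwise. For a graph on $[m]$, the Laplacian simplex $\mathcal{P}_G$ is the convex hull in $\mathbb{R}^{m-1}$ of the rows of the Laplacian with its $m$-th column deleted. A lattice polytope is reflexive if it contains the origin in its interior and its dual is a lattice polytope. The whiskered graph $\mathcal{W}(G)$ has vertex set $[2n]$ and edge set $E(G)\cup\{\{i,i+n\}: i\in[n]\}$. $[M\mid\mathbb{1}]$ denotes $M$ with a column of ones appended. For a lattice simplex with ordered vertices $\mathbf{v}_1,\dots,\mathbf{v}_{d+1}\in\mathbb{Z}^d$, the fundamental parallelepiped is $\{\sum_i\lambda_i(\mathbf{v}_i,1)\mid 0\le\lambda_i<1\}$, and $\Lambda(\mathcal{P})$ is the set of $\lambda\in[0,1)^{d+1}$ with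 $\sum_i\lambda_i(\mathbf{v}_i,1)\in\mathbb{Z}^{d+1}$ (here with vertices the rows of the relevant matrix in order).
   Formalization: Convex hulls, the interior, the dual and the fundamental parallelepiped use points with rational coordinates and rational coefficients instead of real ones, and each λ in Λ(𝒫_G) has rational entries. -}

module Defs where

open import Data.Bool using (Bool; true; false; if_then_else_)
open import Data.Nat as ℕ using (ℕ; zero; suc)
open import Data.Fin using (Fin; zero; suc; punchIn; fromℕ; splitAt; _≟_)
open import Data.Integer as ℤ using (ℤ)
open import Data.Rational as ℚ using (ℚ; 0ℚ; 1ℚ)
open import Data.Sum using (_⊎_; inj₁; inj₂)
open import Data.Product using (Σ; ∃; _×_; _,_)
open import Relation.Nullary.Decidable using (⌊_⌋)
open import Relation.Binary.PropositionalEquality using (_≡_)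
open import Function.Bundles using (_⇔_)

-- Convention: the vertex i ∈ [m] of the paper is the index i-1 : Fin m.

record SimpleGraph (m : ℕ) : Set where
  field
    adj    : Fin m → Fin m → Bool
    sym    : ∀ i j → adj i j ≡ adj j i
    irrefl : ∀ i → adj i i ≡ false
open SimpleGraph public

data Walk {m : ℕ} (a : Fin m → Fin m → Bool) : Fin m → Fin m → Set where
  here : ∀ {i} → Walk a i i
  step : ∀ {i j k} → a i j ≡ true → Walk a j k → Walk a i k

Connected : ∀ {m} → SimpleGraph m → Set
Connected G = ∀ i j → Walk (adj G) i j

sumℤ : ∀ {m} → (Fin m → ℤ) → ℤ
sumℤ {zero}  f = ℤ.+ 0
sumℤ {suc m} f = f zero ℤ.+ sumℤ (λ j → f (suc j))

sumℚ : ∀ {m} → (Fin m → ℚ) → ℚ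
sumℚ {zero}  f = 0ℚ
sumℚ {suc m} f = f zero ℚ.+ sumℚ (λ j → f (suc j))

degree : ∀ {m} → (Fin m → Fin m → Bool) → Fin m → ℤ
degree a i = sumℤ (λ j → if a i j then ℤ.+ 1 else ℤ.+ 0)

laplacian : ∀ {m} → (Fin m → Fin m → Bool) → Fin m → Fin m → ℤ
laplacian a i j = if ⌊ i ≟ j ⌋ then degree a i else (if a i j then ℤ.-1ℤ else ℤ.+ 0)

deleteCol : ∀ {r d} → (Fin r → Fin (suc d) → ℤ) → Fin (suc d) → Fin r → Fin d → ℤ
deleteCol M c i j = M i (punchIn c j)

-- Rows of the Laplacian of G on [n] (n = suc k) with its n-th (last) column deleted:
-- the vertices of the Laplacian simplex 𝒫_G ⊂ ℝ^(n-1).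
laplacianSimplex : ∀ {k} → SimpleGraph (suc k) → Fin (suc k) → Fin k → ℤ
laplacianSimplex {k} G = deleteCol (laplacian (adj G)) (fromℕ k)

-- Whiskered graph 𝒲(G) on [2n]: vertex i ∈ [n] ↦ i ↑ˡ n, vertex i+n ↦ raise n i.
whiskeredAdj : ∀ {n} → SimpleGraph n → Fin (n ℕ.+ n) → Fin (n ℕ.+ n) → Bool
whiskeredAdj {n} G u v with splitAt n u | splitAt n v
... | inj₁ i | inj₁ j = adj G i j
... | inj₁ i | inj₂ j = ⌊ i ≟ j ⌋
... | inj₂ i | inj₁ j = ⌊ i ≟ j ⌋
... | inj₂ i | inj₂ j = false

Point : ℕ → Set
Point d = Fin d → ℚ

toℚ : ℤ → ℚ
toℚ z = z ℚ./ 1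

snoc : ∀ {A : Set} {d} → (Fin d → A) → A → Fin (suc d) → A
snoc {d = zero}  x a zero    = a
snoc {d = suc d} x a zero    = x zero
snoc {d = suc d} x a (suc j) = snoc (λ j' → x (suc j')) a j

vecMat : ∀ {r c} → (Fin r → ℚ) → (Fin r → Fin c → ℤ) → Point c
vecMat μ M j = sumℚ (λ i → μ i ℚ.* toℚ (M i j))

appendOnes : ∀ {r d} → (Fin r → Fin d → ℤ) → Fin r → Fin (suc d) → ℤ
appendOnes M i = snoc (M i) (ℤ.+ 1)

InConv : ∀ {m d} → (Fin m → Fin d → ℤ) → Point d → Set
InConv {m} W y = Σ (Fin m → ℚ) λ μ →
  (∀ i → 0ℚ ℚ.≤ μ i) × (sumℚ μ ≡ 1ℚ) × (∀ j → y j ≡ vecMat μ W j)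

OriginInInterior : ∀ {m d} → (Fin m → Fin d → ℤ) → Set
OriginInInterior {d = d} W = Σ ℚ λ ε → (0ℚ ℚ.< ε) ×
  (∀ (y : Point d) → (∀ j → ℚ.∣ y j ∣ ℚ.< ε) → InConv W y)

dot : ∀ {d} → Point d → Point d → ℚ
dot x y = sumℚ (λ j → x j ℚ.* y j)

InDual : ∀ {m d} → (Fin m → Fin d → ℤ) → Point d → Set
InDual {d = d} W y = ∀ (x : Point d) → InConv W x → dot x y ℚ.≤ 1ℚ

IsLatticePolytope : ∀ {d} → (Point d → Set) → Set
IsLatticePolytope {d} S = Σ ℕ λ m → Σ (Fin m → Fin d → ℤ) λ W → ∀ y → S y ⇔ InConv W y

Reflexive : ∀ {m d} → (Fin m → Fin d → ℤ) → Set
Reflexive W = OriginInInterior W × IsLatticePolytope (InDual W)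

IsLatticePoint : ∀ {d} → Point d → Set
IsLatticePoint y = ∀ j → Σ ℤ λ z → y j ≡ toℚ z

InHalfOpenCube : ∀ {r} → (Fin r → ℚ) → Set
InHalfOpenCube μ = ∀ i → (0ℚ ℚ.≤ μ i) × (μ i ℚ.< 1ℚ)

InFundPar : ∀ {d} → (Fin (suc d) → Fin d → ℤ) → Point (suc d) → Set
InFundPar {d} V y = Σ (Fin (suc d) → ℚ) λ μ →
  InHalfOpenCube μ × (∀ j → y j ≡ vecMat μ (appendOnes V) j)

InΛ : ∀ {d} → (Fin (suc d) → Fin d → ℤ) → (Fin (suc d) → ℚ) → Set
InΛ V μ = InHalfOpenCube μ × IsLatticePoint (vecMat μ (appendOnes V))

dup : ∀ {n} → (Fin n → ℚ) → Fin (n ℕ.+ n) → ℚ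
dup {n} μ u with splitAt n u
... | inj₁ i = μ i
... | inj₂ i = μ i

-- Write M = [L(n) | 𝟙]. The column of the whisker vertex n+i reads off μ_{n+i} − μ_i from μ·M, so an
-- integer point μ·M with μ ∈ [0,1)^{2n} has μ = (λ, λ); the columns of G then say that λ·L_G(n) is
-- integral and the last column that 2∑λ is. If ∑λ ∈ ℤ, then λ ∈ Λ(𝒫_G); otherwise
-- λ − 1/(2n) ∈ Λ(𝒫_G), provided every λᵢ ≥ 1/(2n). This bound, and λᵢ + 1/(2n) < 1 for the converse,
-- come from reflexivity: the facet of 𝒫_G opposite its i-th vertex has a lattice normal w, i.e.
-- ⟨Lⱼ, w⟩ = 1 for the rows j ≠ i of L_G(n), and pairing λ·L_G(n) with w shows that ∑λ − n λᵢ ∈ ℤ.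

module Submission where

open import Defs hiding (sym)
open import Data.Nat as ℕ using (ℕ; zero; suc; _+_)
import Data.Nat.Properties as ℕP
open import Data.Fin using (Fin; zero; suc; fromℕ; inject₁; _↑ˡ_; _↑ʳ_; punchIn; splitAt; _≟_)
import Data.Fin.Properties as FinP
open import Data.Fin.Relation.Unary.Top using (View; view; ‵fromℕ; ‵inject₁)
open import Data.Integer as ℤ using (ℤ; +_; -[1+_])
import Data.Integer.Properties as ℤP
import Data.Integer.DivMod as DivMod
import Data.Integer.Solver
open import Data.Rational as ℚ using (ℚ; 0ℚ; 1ℚ; _/_) renaming (_+_ to _+ℚ_)
import Data.Rational.Properties as ℚP
open import Data.Rational.Unnormalised as ℚᵘ using (ℚᵘ; mkℚᵘ; *≡*; *≤*; *<*)
import Data.Rational.Unnormalised.Properties as ℚᵘP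
open import Data.Rational.Solver using (module +-*-Solver)
open import Data.Bool using (Bool; true; false; if_then_else_)
open import Data.Empty using (⊥-elim)
open import Data.Product using (Σ; _,_; proj₁; proj₂; _×_)
open import Data.Sum using (_⊎_; inj₁; inj₂)
open import Function using (_∘_)
open import Function.Bundles using (_⇔_; mk⇔; Equivalence)
open import Relation.Nullary.Decidable using (⌊_⌋; yes; no)
open import Relation.Binary.PropositionalEquality hiding (J)
open import Algebra.Bundles using (CommutativeRing)
open import Algebra.Structures using (IsCommutativeRing)
open import Algebra.Properties.Group ℚP.+-0-group using (x∙y⁻¹≈ε⇒x≈y)

open +-*-Solver
module ℤSolver = Data.Integer.Solver.+-*-Solver

module SumProperties {A : Set} {_+_ _*_ : A → A → A} { -_ : A → A } {0# 1# : A}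
  (isCommutativeRing : IsCommutativeRing _≡_ _+_ _*_ -_ 0# 1#)
  (∑ : ∀ {m} → (Fin m → A) → A)
  (∑-zero : (f : Fin 0 → A) → ∑ f ≡ 0#)
  (∑-suc : ∀ {m} (f : Fin (suc m) → A) → ∑ f ≡ f zero + ∑ (f ∘ suc))
  where

  private
    commutativeRing : CommutativeRing _ _
    commutativeRing = record { isCommutativeRing = isCommutativeRing }

  open CommutativeRing commutativeRing using (+-assoc; +-identityˡ; +-identityʳ; semiring; ring)
  open import Algebra.Properties.Semiring.Sum semiring as Sum
    using (sum; sum-cong-≗; sum-replicate-zero; ∑-distrib-+; *-distribˡ-sum; *-distribʳ-sum)
  open import Algebra.Properties.Ring ring using (-1*x≈-x)

  private
    ∑≗sum : ∀ {m} (f : Fin m → A) → ∑ f ≡ sum f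
    ∑≗sum {zero}  f = ∑-zero f
    ∑≗sum {suc m} f = trans (∑-suc f) (cong (λ s → f zero + s) (∑≗sum (f ∘ suc)))

  ∑-cong : ∀ {m} {f g : Fin m → A} → (∀ i → f i ≡ g i) → ∑ f ≡ ∑ g
  ∑-cong {f = f} {g} f≗g = trans (∑≗sum f) (trans (sum-cong-≗ f≗g) (sym (∑≗sum g)))

  ∑-0 : ∀ m → ∑ {m} (λ _ → 0#) ≡ 0#
  ∑-0 m = trans (∑≗sum _) (sum-replicate-zero m)

  ∑-+ : ∀ {m} (f g : Fin m → A) → ∑ (λ i → f i + g i) ≡ ∑ f + ∑ g
  ∑-+ f g = trans (∑≗sum _) (trans (∑-distrib-+ f g) (sym (cong₂ _+_ (∑≗sum f) (∑≗sum g))))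

  ∑-*ˡ : ∀ {m} c (f : Fin m → A) → ∑ (λ i → c * f i) ≡ c * ∑ f
  ∑-*ˡ c f = trans (∑≗sum _) (trans (sym (*-distribˡ-sum c f)) (cong (c *_) (sym (∑≗sum f))))

  ∑-*ʳ : ∀ {m} c (f : Fin m → A) → ∑ (λ i → f i * c) ≡ ∑ f * c
  ∑-*ʳ c f = trans (∑≗sum _) (trans (sym (*-distribʳ-sum c f)) (cong (_* c) (sym (∑≗sum f))))

  ∑-neg : ∀ {m} (f : Fin m → A) → ∑ (λ i → - f i) ≡ - ∑ f
  ∑-neg f = trans (∑-cong (λ i → sym (-1*x≈-x (f i)))) (trans (∑-*ˡ (- 1#) f) (-1*x≈-x (∑ f)))

  ∑-minus : ∀ {m} (f g : Fin m → A) → ∑ (λ i → f i + (- g i)) ≡ ∑ f + (- ∑ g)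
  ∑-minus f g = trans (∑-+ f (λ i → - g i)) (cong (λ s → ∑ f + s) (∑-neg g))

  ∑-comm : ∀ {m p} (f : Fin m → Fin p → A) → ∑ (λ i → ∑ (f i)) ≡ ∑ (λ j → ∑ (λ i → f i j))
  ∑-comm {m} f = begin
    ∑ (λ i → ∑ (f i))            ≡⟨ trans (∑≗sum _) (sum-cong-≗ (λ i → ∑≗sum (f i))) ⟩
    sum (λ i → sum (f i))        ≡⟨ Sum.∑-comm f ⟩
    sum (λ j → sum (λ i → f i j)) ≡⟨ sym (trans (∑≗sum _) (sum-cong-≗ (λ j → ∑≗sum {m} (λ i → f i j)))) ⟩
    ∑ (λ j → ∑ (λ i → f i j))    ∎
    where open ≡-Reasoning

  ∑-init-last : ∀ {m} (f : Fin (suc m) → A) → ∑ f ≡ ∑ (f ∘ inject₁) + f (fromℕ m)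
  ∑-init-last f = trans (∑≗sum f) (trans (Sum.sum-init-last f) (cong (_+ _) (sym (∑≗sum _))))

  ∑-remove : ∀ {m} (i : Fin (suc m)) (f : Fin (suc m) → A) → ∑ f ≡ f i + ∑ (f ∘ punchIn i)
  ∑-remove i f = trans (∑≗sum f) (trans (Sum.sum-remove f) (cong (λ s → f i + s) (sym (∑≗sum _))))

  ∑-↑ : ∀ m {n} (f : Fin (m ℕ.+ n) → A) → ∑ f ≡ ∑ (λ i → f (i ↑ˡ n)) + ∑ (λ j → f (m ↑ʳ j))
  ∑-↑ zero    f = sym (trans (cong (_+ ∑ f) (∑-zero _)) (+-identityˡ (∑ f)))
  ∑-↑ (suc m) f = begin
    ∑ f                                                               ≡⟨ ∑-suc f ⟩
    f zero + ∑ (f ∘ suc)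
      ≡⟨ cong (λ s → f zero + s) (∑-↑ m (f ∘ suc)) ⟩
    f zero + (∑ (λ i → f (suc (i ↑ˡ _))) + ∑ (λ j → f (suc m ↑ʳ j)))  ≡⟨ sym (+-assoc _ _ _) ⟩
    (f zero + ∑ (λ i → f (suc (i ↑ˡ _)))) + ∑ (λ j → f (suc m ↑ʳ j))  ≡⟨ cong (_+ _) (sym (∑-suc _)) ⟩
    ∑ (λ i → f (i ↑ˡ _)) + ∑ (λ j → f (suc m ↑ʳ j))                  ∎
    where open ≡-Reasoning

  ∑-single : ∀ {m} (i : Fin m) (f : Fin m → A) → (∀ j → j ≢ i → f j ≡ 0#) → ∑ f ≡ f i
  ∑-single {suc m} zero    f f≡0 = begin
    ∑ f                   ≡⟨ ∑-suc f ⟩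
    f zero + ∑ (f ∘ suc)  ≡⟨ cong (λ s → f zero + s) (trans (∑-cong (λ j → f≡0 (suc j) λ ())) (∑-0 m)) ⟩
    f zero + 0#           ≡⟨ +-identityʳ (f zero) ⟩
    f zero                ∎
    where open ≡-Reasoning
  ∑-single {suc m} (suc i) f f≡0 = begin
    ∑ f                   ≡⟨ ∑-suc f ⟩
    f zero + ∑ (f ∘ suc)
      ≡⟨ cong₂ _+_ (f≡0 zero λ ()) (∑-single i (f ∘ suc) (λ j j≢i → f≡0 (suc j) (j≢i ∘ FinP.suc-injective))) ⟩
    0# + f (suc i)        ≡⟨ +-identityˡ (f (suc i)) ⟩
    f (suc i)             ∎
    where open ≡-Reasoning

-- toℚ z = z / 1 is the normalisation of the unnormalised fraction ι z, so its algebraic and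
-- order properties are transported from those of ℚᵘ along toℚᵘ.
private
  ι : ℤ → ℚᵘ
  ι z = mkℚᵘ z 0

  toℚᵘ-toℚ : ∀ z → ℚ.toℚᵘ (toℚ z) ℚᵘ.≃ ι z
  toℚᵘ-toℚ z = ℚP.toℚᵘ-fromℚᵘ (ι z)

toℚ-+ : ∀ a b → toℚ (a ℤ.+ b) ≡ toℚ a ℚ.+ toℚ b
toℚ-+ a b = ℚP.toℚᵘ-injective (begin
  ℚ.toℚᵘ (toℚ (a ℤ.+ b))                  ≈⟨ toℚᵘ-toℚ (a ℤ.+ b) ⟩
  ι (a ℤ.+ b)
    ≈⟨ *≡* (cong (ℤ._* + 1) (cong₂ ℤ._+_ (sym (ℤP.*-identityʳ a)) (sym (ℤP.*-identityʳ b)))) ⟩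
  ι a ℚᵘ.+ ι b                             ≈⟨ ℚᵘP.+-cong (ℚᵘP.≃-sym (toℚᵘ-toℚ a)) (ℚᵘP.≃-sym (toℚᵘ-toℚ b)) ⟩
  ℚ.toℚᵘ (toℚ a) ℚᵘ.+ ℚ.toℚᵘ (toℚ b)      ≈⟨ ℚᵘP.≃-sym (ℚP.toℚᵘ-homo-+ (toℚ a) (toℚ b)) ⟩
  ℚ.toℚᵘ (toℚ a ℚ.+ toℚ b)                ∎)
  where open ℚᵘP.≃-Reasoning

toℚ-* : ∀ a b → toℚ (a ℤ.* b) ≡ toℚ a ℚ.* toℚ b
toℚ-* a b = ℚP.toℚᵘ-injective (begin
  ℚ.toℚᵘ (toℚ (a ℤ.* b))                  ≈⟨ toℚᵘ-toℚ (a ℤ.* b) ⟩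
  ι a ℚᵘ.* ι b                             ≈⟨ ℚᵘP.*-cong (ℚᵘP.≃-sym (toℚᵘ-toℚ a)) (ℚᵘP.≃-sym (toℚᵘ-toℚ b)) ⟩
  ℚ.toℚᵘ (toℚ a) ℚᵘ.* ℚ.toℚᵘ (toℚ b)      ≈⟨ ℚᵘP.≃-sym (ℚP.toℚᵘ-homo-* (toℚ a) (toℚ b)) ⟩
  ℚ.toℚᵘ (toℚ a ℚ.* toℚ b)                ∎)
  where open ℚᵘP.≃-Reasoning

toℚ-neg : ∀ a → toℚ (ℤ.- a) ≡ ℚ.- toℚ a
toℚ-neg a = ℚP.toℚᵘ-injective (begin
  ℚ.toℚᵘ (toℚ (ℤ.- a))      ≈⟨ toℚᵘ-toℚ (ℤ.- a) ⟩
  ℚᵘ.- ι a                   ≈⟨ ℚᵘP.-‿cong (ℚᵘP.≃-sym (toℚᵘ-toℚ a)) ⟩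
  ℚᵘ.- ℚ.toℚᵘ (toℚ a)       ≈⟨ ℚᵘP.≃-sym (ℚP.toℚᵘ-homo‿- (toℚ a)) ⟩
  ℚ.toℚᵘ (ℚ.- toℚ a)        ∎)
  where open ℚᵘP.≃-Reasoning

toℚ-minus : ∀ a b → toℚ (a ℤ.- b) ≡ toℚ a ℚ.- toℚ b
toℚ-minus a b = trans (toℚ-+ a (ℤ.- b)) (cong (toℚ a ℚ.+_) (toℚ-neg b))

toℚ-mono-≤ : ∀ {a b} → a ℤ.≤ b → toℚ a ℚ.≤ toℚ b
toℚ-mono-≤ {a} {b} a≤b = ℚP.toℚᵘ-cancel-≤ (ℚᵘP.≤-respʳ-≃ (ℚᵘP.≃-sym (toℚᵘ-toℚ b)) (ℚᵘP.≤-respˡ-≃ (ℚᵘP.≃-sym (toℚᵘ-toℚ a))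
  (*≤* (subst₂ ℤ._≤_ (sym (ℤP.*-identityʳ a)) (sym (ℤP.*-identityʳ b)) a≤b))))

toℚ-mono-< : ∀ {a b} → a ℤ.< b → toℚ a ℚ.< toℚ b
toℚ-mono-< {a} {b} a<b = ℚP.toℚᵘ-cancel-< (ℚᵘP.<-respʳ-≃ (ℚᵘP.≃-sym (toℚᵘ-toℚ b)) (ℚᵘP.<-respˡ-≃ (ℚᵘP.≃-sym (toℚᵘ-toℚ a))
  (*<* (subst₂ ℤ._<_ (sym (ℤP.*-identityʳ a)) (sym (ℤP.*-identityʳ b)) a<b))))

toℚ-cancel-≤ : ∀ {a b} → toℚ a ℚ.≤ toℚ b → a ℤ.≤ b
toℚ-cancel-≤ {a} {b} le with ℚᵘP.≤-respʳ-≃ (toℚᵘ-toℚ b) (ℚᵘP.≤-respˡ-≃ (toℚᵘ-toℚ a) (ℚP.toℚᵘ-mono-≤ le))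
... | *≤* a≤b = subst₂ ℤ._≤_ (ℤP.*-identityʳ a) (ℤP.*-identityʳ b) a≤b

toℚ-cancel-< : ∀ {a b} → toℚ a ℚ.< toℚ b → a ℤ.< b
toℚ-cancel-< {a} {b} lt with ℚᵘP.<-respʳ-≃ (toℚᵘ-toℚ b) (ℚᵘP.<-respˡ-≃ (toℚᵘ-toℚ a) (ℚP.toℚᵘ-mono-< lt))
... | *<* a<b = subst₂ ℤ._<_ (ℤP.*-identityʳ a) (ℤP.*-identityʳ b) a<b

module Sumℚ = SumProperties ℚP.+-*-isCommutativeRing sumℚ (λ _ → refl) (λ _ → refl)
module Sumℤ = SumProperties ℤP.+-*-isCommutativeRing sumℤ (λ _ → refl) (λ _ → refl)
open Sumℚ

toℚ-sum : ∀ {m} (f : Fin m → ℤ) → toℚ (sumℤ f) ≡ sumℚ (toℚ ∘ f)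
toℚ-sum {zero}  f = refl
toℚ-sum {suc m} f = trans (toℚ-+ (f zero) (sumℤ (f ∘ suc))) (cong (λ s → toℚ (f zero) ℚ.+ s) (toℚ-sum (f ∘ suc)))

sumℚ-const-1 : ∀ m → sumℚ {m} (λ _ → 1ℚ) ≡ toℚ (+ m)
sumℚ-const-1 zero    = refl
sumℚ-const-1 (suc m) = trans (cong (1ℚ ℚ.+_) (sumℚ-const-1 m)) (sym (toℚ-+ (+ 1) (+ m)))

sumℚ-mono-≤ : ∀ {m} {f g : Fin m → ℚ} → (∀ i → f i ℚ.≤ g i) → sumℚ f ℚ.≤ sumℚ g
sumℚ-mono-≤ {zero}  f≤g = ℚP.≤-refl
sumℚ-mono-≤ {suc m} f≤g = ℚP.+-mono-≤ (f≤g zero) (sumℚ-mono-≤ (f≤g ∘ suc))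

sumℚ-nonNeg : ∀ {m} {f : Fin m → ℚ} → (∀ i → 0ℚ ℚ.≤ f i) → 0ℚ ℚ.≤ sumℚ f
sumℚ-nonNeg {m} {f} 0≤f = subst (ℚ._≤ sumℚ f) (∑-0 m) (sumℚ-mono-≤ 0≤f)

term≤sumℚ : ∀ {m} {f : Fin m → ℚ} → (∀ i → 0ℚ ℚ.≤ f i) → ∀ i → f i ℚ.≤ sumℚ f
term≤sumℚ {suc m} {f} 0≤f i = begin
  f i                               ≡⟨ ℚP.+-identityʳ (f i) ⟨
  f i ℚ.+ 0ℚ                        ≤⟨ ℚP.+-monoʳ-≤ (f i) (sumℚ-nonNeg (0≤f ∘ punchIn i)) ⟩
  f i ℚ.+ sumℚ (f ∘ punchIn i) ≡⟨ ∑-remove i f ⟨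
  sumℚ f                            ∎
  where open ℚP.≤-Reasoning

sumℚ-nonNeg-≡0 : ∀ {m} {f : Fin m → ℚ} → (∀ i → 0ℚ ℚ.≤ f i) → sumℚ f ≡ 0ℚ → ∀ i → f i ≡ 0ℚ
sumℚ-nonNeg-≡0 0≤f ∑f≡0 i = ℚP.≤-antisym (subst (_ ℚ.≤_) ∑f≡0 (term≤sumℚ 0≤f i)) (0≤f i)

sumℚ-shift : ∀ {m} (a : Fin m → ℚ) c → sumℚ (λ j → a j ℚ.+ c) ≡ sumℚ a ℚ.+ toℚ (+ m) ℚ.* c
sumℚ-shift {m} a c = trans (∑-+ a (λ _ → c)) (cong (sumℚ a ℚ.+_)
  (trans (∑-cong {m} (λ _ → sym (ℚP.*-identityˡ c))) (trans (∑-*ʳ {m} c (λ _ → 1ℚ)) (cong (ℚ._* c) (sumℚ-const-1 m)))))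

last≡sum-sumInit : ∀ {k} (f : Fin (suc k) → ℚ) → f (fromℕ k) ≡ sumℚ f ℚ.- sumℚ (f ∘ inject₁)
last≡sum-sumInit f = begin
  f (fromℕ _)
    ≡⟨ solve 2 (λ x s → x := (s :+ x) :- s) refl (f (fromℕ _)) (sumℚ (f ∘ inject₁)) ⟩
  (sumℚ (f ∘ inject₁) ℚ.+ f (fromℕ _)) ℚ.- sumℚ (f ∘ inject₁)
    ≡⟨ cong (ℚ._- sumℚ (f ∘ inject₁)) (∑-init-last f) ⟨
  sumℚ f ℚ.- sumℚ (f ∘ inject₁)                        ∎
  where open ≡-Reasoning

≗-init⇒≡-last : ∀ {k} {f g : Fin (suc k) → ℚ} → sumℚ f ≡ sumℚ g →
  (∀ p → f (inject₁ p) ≡ g (inject₁ p)) → f (fromℕ k) ≡ g (fromℕ k)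
≗-init⇒≡-last {f = f} {g} Σf≡Σg f≗g =
  trans (last≡sum-sumInit f) (trans (cong₂ ℚ._-_ Σf≡Σg (∑-cong f≗g)) (sym (last≡sum-sumInit g)))

sumℚ-*-ones-but-one : ∀ {m} (i : Fin m) (a t : Fin m → ℚ) → (∀ j → j ≢ i → t j ≡ 1ℚ) → sumℚ t ≡ 0ℚ →
  sumℚ (λ j → a j ℚ.* t j) ≡ sumℚ a ℚ.- sumℚ {m} (λ _ → 1ℚ) ℚ.* a i
sumℚ-*-ones-but-one {m} i a t t≡1 Σt≡0 = begin
  sumℚ (λ j → a j ℚ.* t j)
    ≡⟨ ∑-cong (λ j → solve 2 (λ x u → x :* u := x :- x :* (con 1ℚ :- u)) refl (a j) (t j)) ⟩
  sumℚ (λ j → a j ℚ.- a j ℚ.* s j)           ≡⟨ ∑-minus a (λ j → a j ℚ.* s j) ⟩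
  sumℚ a ℚ.- sumℚ (λ j → a j ℚ.* s j)
    ≡⟨ cong (λ x → sumℚ a ℚ.- x) (∑-single i (λ j → a j ℚ.* s j) (λ j j≢i → trans (cong (a j ℚ.*_) (s≡0 j j≢i)) (ℚP.*-zeroʳ (a j)))) ⟩
  sumℚ a ℚ.- a i ℚ.* s i
    ≡⟨ cong (λ x → sumℚ a ℚ.- a i ℚ.* x) (trans (sym (∑-single i s s≡0)) Σs≡N) ⟩
  sumℚ a ℚ.- a i ℚ.* N                       ≡⟨ cong (λ x → sumℚ a ℚ.- x) (ℚP.*-comm (a i) N) ⟩
  sumℚ a ℚ.- N ℚ.* a i                       ∎
  where
  open ≡-Reasoning
  N = sumℚ {m} (λ _ → 1ℚ)
  s : Fin m → ℚ
  s j = 1ℚ ℚ.- t j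
  s≡0 : ∀ j → j ≢ i → s j ≡ 0ℚ
  s≡0 j j≢i = trans (cong (λ x → 1ℚ ℚ.- x) (t≡1 j j≢i)) (ℚP.+-inverseʳ 1ℚ)
  Σs≡N : sumℚ s ≡ N
  Σs≡N = trans (∑-minus (λ _ → 1ℚ) t) (trans (cong (λ x → N ℚ.- x) Σt≡0) (ℚP.+-identityʳ N))

IsInteger : ℚ → Set
IsInteger q = Σ ℤ λ z → q ≡ toℚ z

isInteger-+ : ∀ {p q} → IsInteger p → IsInteger q → IsInteger (p ℚ.+ q)
isInteger-+ (a , refl) (b , refl) = a ℤ.+ b , sym (toℚ-+ a b)

isInteger-* : ∀ {p q} → IsInteger p → IsInteger q → IsInteger (p ℚ.* q)
isInteger-* (a , refl) (b , refl) = a ℤ.* b , sym (toℚ-* a b)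

isInteger-sum : ∀ {m} {f : Fin m → ℚ} → (∀ i → IsInteger (f i)) → IsInteger (sumℚ f)
isInteger-sum {zero}  _    = + 0 , refl
isInteger-sum {suc m} intf = isInteger-+ (intf zero) (isInteger-sum (intf ∘ suc))

p≤q⇒0≤q-p : ∀ {p q} → p ℚ.≤ q → 0ℚ ℚ.≤ q ℚ.- p
p≤q⇒0≤q-p {p} {q} p≤q = subst (ℚ._≤ q ℚ.- p) (ℚP.+-inverseʳ p) (ℚP.+-monoˡ-≤ (ℚ.- p) p≤q)

*-nonNeg : ∀ {p q} → 0ℚ ℚ.≤ p → 0ℚ ℚ.≤ q → 0ℚ ℚ.≤ p ℚ.* q
*-nonNeg {p} {q} 0≤p 0≤q =
  ℚP.nonNegative⁻¹ _ {{ℚP.nonNeg*nonNeg⇒nonNeg p {{ℚ.nonNegative 0≤p}} q {{ℚ.nonNegative 0≤q}}}}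

*-≡0⇒≡0 : ∀ {p q} → p ≢ 0ℚ → p ℚ.* q ≡ 0ℚ → q ≡ 0ℚ
*-≡0⇒≡0 {p} {q} p≢0 pq≡0 = begin
  q                       ≡⟨ ℚP.*-identityˡ q ⟨
  1ℚ ℚ.* q                ≡⟨ cong (ℚ._* q) (ℚP.*-inverseˡ p) ⟨
  (ℚ.1/ p) ℚ.* p ℚ.* q    ≡⟨ ℚP.*-assoc (ℚ.1/ p) p q ⟩
  (ℚ.1/ p) ℚ.* (p ℚ.* q)  ≡⟨ cong ((ℚ.1/ p) ℚ.*_) pq≡0 ⟩
  (ℚ.1/ p) ℚ.* 0ℚ         ≡⟨ ℚP.*-zeroʳ (ℚ.1/ p) ⟩
  0ℚ                      ∎
  where
  open ≡-Reasoning
  instance _ = ℚ.≢-nonZero p≢0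

half-open-unique : ∀ {p q} → 0ℚ ℚ.≤ p × p ℚ.< 1ℚ → 0ℚ ℚ.≤ q × q ℚ.< 1ℚ → IsInteger (q ℚ.- p) → q ≡ p
half-open-unique {p} {q} (0≤p , p<1) (0≤q , q<1) (z , q-p≡z) = begin
  q                    ≡⟨ solve 2 (λ p q → q := (q :- p) :+ p) refl p q ⟩
  (q ℚ.- p) ℚ.+ p
    ≡⟨ cong (ℚ._+ p) (trans q-p≡z (cong toℚ (z≡0 z (toℚ-cancel-< (subst (ℚ._< 1ℚ) q-p≡z q-p<1))
                                                   (toℚ-cancel-< (subst (ℚ.- 1ℚ ℚ.<_) q-p≡z -1<q-p))))) ⟩
  0ℚ ℚ.+ p             ≡⟨ ℚP.+-identityˡ p ⟩
  p                    ∎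
  where
  open ≡-Reasoning
  q-p<1 : q ℚ.- p ℚ.< 1ℚ
  q-p<1 = ℚP.≤-<-trans (subst (q ℚ.- p ℚ.≤_) (ℚP.+-identityʳ q) (ℚP.+-monoʳ-≤ q (ℚP.neg-antimono-≤ 0≤p))) q<1
  -1<q-p : ℚ.- 1ℚ ℚ.< q ℚ.- p
  -1<q-p = ℚP.<-≤-trans (subst (ℚ._< 0ℚ ℚ.- p) (ℚP.+-identityˡ (ℚ.- 1ℚ)) (ℚP.+-monoʳ-< 0ℚ (ℚP.neg-antimono-< p<1)))
                        (ℚP.+-monoˡ-≤ (ℚ.- p) 0≤q)
  z≡0 : ∀ z → z ℤ.< + 1 → ℤ.-1ℤ ℤ.< z → z ≡ + 0
  z≡0 (+ zero)  _                   _ = refl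
  z≡0 (+ suc _) (ℤ.+<+ (ℕ.s≤s ())) _
  z≡0 -[1+ _ ]  _                   (ℤ.-<- ())

x+x≡q+q⇒x≡q : ∀ x q → x ℚ.+ x ≡ toℚ (q ℤ.+ q) → x ≡ toℚ q
x+x≡q+q⇒x≡q x q x+x≡ = begin
  x                          ≡⟨ solve 1 (λ x → x := con ℚ.½ :* (x :+ x)) refl x ⟩
  ℚ.½ ℚ.* (x ℚ.+ x)          ≡⟨ cong (ℚ.½ ℚ.*_) (trans x+x≡ (toℚ-+ q q)) ⟩
  ℚ.½ ℚ.* (toℚ q ℚ.+ toℚ q)  ≡⟨ solve 1 (λ x → con ℚ.½ :* (x :+ x) := x) refl (toℚ q) ⟩
  toℚ q                      ∎
  where open ≡-Reasoning

parity : ∀ t → Σ ℤ λ q → (t ≡ q ℤ.+ q) ⊎ (t ≡ + 1 ℤ.+ (q ℤ.+ q))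
parity t = classify (t DivMod.%ℕ 2) (t DivMod./ℕ 2) (DivMod.n%ℕd<d t 2) (DivMod.a≡a%ℕn+[a/ℕn]*n t 2)
  where
  q*2≡q+q : ∀ q → q ℤ.* + 2 ≡ q ℤ.+ q
  q*2≡q+q = ℤSolver.solve 1 (λ q → q ℤSolver.:* ℤSolver.con (+ 2) ℤSolver.:= q ℤSolver.:+ q) refl
  classify : ∀ r q → r ℕ.< 2 → t ≡ + r ℤ.+ q ℤ.* + 2 → Σ ℤ λ q → (t ≡ q ℤ.+ q) ⊎ (t ≡ + 1 ℤ.+ (q ℤ.+ q))
  classify 0 q _ t≡ = q , inj₁ (trans t≡ (trans (ℤP.+-identityˡ _) (q*2≡q+q q)))
  classify 1 q _ t≡ = q , inj₂ (trans t≡ (cong (λ x → + 1 ℤ.+ x) (q*2≡q+q q)))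
  classify (suc (suc _)) q (ℕ.s≤s (ℕ.s≤s ())) _

odd-nonNeg⇒≥1 : ∀ v → + 0 ℤ.≤ + 1 ℤ.+ (v ℤ.+ v) → + 1 ℤ.≤ + 1 ℤ.+ (v ℤ.+ v)
odd-nonNeg⇒≥1 (+ _)      _ = ℤ.+≤+ (ℕ.s≤s ℕ.z≤n)
odd-nonNeg⇒≥1 -[1+ _ ]  ()

<⇒odd<even : ∀ {w n} → w ℤ.< + n → (w ℤ.+ w) ℤ.+ + 1 ℤ.< + n ℤ.+ + n
<⇒odd<even {w} {n} w<n = ℤP.suc[i]≤j⇒i<j (subst (ℤ._≤ + n ℤ.+ + n) (sym (eq w)) (ℤP.+-mono-≤ 1+w≤n 1+w≤n))
  where
  1+w≤n = ℤP.i<j⇒suc[i]≤j w<n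
  eq : ∀ w → ℤ.suc ((w ℤ.+ w) ℤ.+ + 1) ≡ ℤ.suc w ℤ.+ ℤ.suc w
  eq = ℤSolver.solve 1 (λ w → ℤSolver.con (+ 1) ℤSolver.:+ ((w ℤSolver.:+ w) ℤSolver.:+ ℤSolver.con (+ 1))
                       ℤSolver.:= (ℤSolver.con (+ 1) ℤSolver.:+ w) ℤSolver.:+ (ℤSolver.con (+ 1) ℤSolver.:+ w)) refl

toℚ-*-1/ : ∀ m → toℚ (+ suc m) ℚ.* (+ 1 ℚ./ suc m) ≡ 1ℚ
toℚ-*-1/ m = ℚP.toℚᵘ-injective (begin
  ℚ.toℚᵘ (toℚ (+ suc m) ℚ.* (+ 1 ℚ./ suc m))          ≈⟨ ℚP.toℚᵘ-homo-* (toℚ (+ suc m)) (+ 1 ℚ./ suc m) ⟩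
  ℚ.toℚᵘ (toℚ (+ suc m)) ℚᵘ.* ℚ.toℚᵘ (+ 1 ℚ./ suc m)
    ≈⟨ ℚᵘP.*-cong (toℚᵘ-toℚ (+ suc m)) (ℚP.toℚᵘ-fromℚᵘ (mkℚᵘ (+ 1) m)) ⟩
  ι (+ suc m) ℚᵘ.* mkℚᵘ (+ 1) m
    ≈⟨ *≡* (cong (λ x → + suc x) (trans (ℕP.*-identityʳ (m ℕ.* 1)) (trans (ℕP.*-identityʳ m) (sym (trans (ℕP.+-identityʳ _) (ℕP.+-identityʳ m)))))) ⟩
  ℚ.toℚᵘ 1ℚ                                            ∎)
  where open ℚᵘP.≃-Reasoning

⌊≟⌋-refl : ∀ {m} (i : Fin m) → ⌊ i ≟ i ⌋ ≡ true
⌊≟⌋-refl i with i ≟ i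
... | yes _  = refl
... | no i≢i = ⊥-elim (i≢i refl)

⌊≟⌋-≢ : ∀ {m} {i j : Fin m} → i ≢ j → ⌊ i ≟ j ⌋ ≡ false
⌊≟⌋-≢ {i = i} {j} i≢j with i ≟ j
... | yes i≡j = ⊥-elim (i≢j i≡j)
... | no _    = refl

↑ˡ≢↑ʳ : ∀ {m} n (i : Fin m) (j : Fin n) → i ↑ˡ n ≢ m ↑ʳ j
↑ˡ≢↑ʳ {m} n i j eq
  with () ← trans (sym (FinP.splitAt-↑ˡ m i n)) (trans (cong (splitAt m) eq) (FinP.splitAt-↑ʳ m n j))

data SplitView (m n : ℕ) : Fin (m ℕ.+ n) → Set where
  left  : (i : Fin m) → SplitView m n (i ↑ˡ n)
  right : (j : Fin n) → SplitView m n (m ↑ʳ j)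

splitView : ∀ m n (u : Fin (m ℕ.+ n)) → SplitView m n u
splitView m n u with splitAt m u in eq
... | inj₁ i = subst (SplitView m n) (FinP.splitAt⁻¹-↑ˡ eq) (left i)
... | inj₂ j = subst (SplitView m n) (FinP.splitAt⁻¹-↑ʳ eq) (right j)

punchIn-fromℕ : ∀ k (j : Fin k) → punchIn (fromℕ k) j ≡ inject₁ j
punchIn-fromℕ (suc k) zero    = refl
punchIn-fromℕ (suc k) (suc j) = cong suc (punchIn-fromℕ k j)

punchIn-↑ˡ : ∀ {m} (i : Fin (suc m)) (j : Fin m) n → punchIn (i ↑ˡ n) (j ↑ˡ n) ≡ punchIn i j ↑ˡ n
punchIn-↑ˡ zero    j       n = refl
punchIn-↑ˡ (suc i) zero    n = refl
punchIn-↑ˡ (suc i) (suc j) n = cong suc (punchIn-↑ˡ i j n)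

punchIn-fromℕ↑ˡ-↑ʳ : ∀ k n (j : Fin n) → punchIn (fromℕ k ↑ˡ n) (k ↑ʳ j) ≡ suc k ↑ʳ j
punchIn-fromℕ↑ˡ-↑ʳ zero    n j = refl
punchIn-fromℕ↑ˡ-↑ʳ (suc k) n j = cong suc (punchIn-fromℕ↑ˡ-↑ʳ k n j)

snoc-inject₁ : ∀ {A : Set} {d} (x : Fin d → A) a (j : Fin d) → snoc x a (inject₁ j) ≡ x j
snoc-inject₁ {d = suc d} x a zero    = refl
snoc-inject₁ {d = suc d} x a (suc j) = snoc-inject₁ (x ∘ suc) a j

snoc-fromℕ : ∀ {A : Set} {d} (x : Fin d → A) a → snoc x a (fromℕ d) ≡ a
snoc-fromℕ {d = zero}  x a = refl
snoc-fromℕ {d = suc d} x a = snoc-fromℕ (x ∘ suc) a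

dup-↑ˡ : ∀ {n} (a : Fin n → ℚ) i → dup a (i ↑ˡ n) ≡ a i
dup-↑ˡ {n} a i rewrite FinP.splitAt-↑ˡ n i n = refl

dup-↑ʳ : ∀ {n} (a : Fin n → ℚ) i → dup a (n ↑ʳ i) ≡ a i
dup-↑ʳ {n} a i rewrite FinP.splitAt-↑ʳ n n i = refl

dup-∘ : ∀ {n} (h : ℚ → ℚ) (a : Fin n → ℚ) u → dup (h ∘ a) u ≡ h (dup a u)
dup-∘ {n} h a u with splitAt n u
... | inj₁ i = refl
... | inj₂ i = refl

dup-unique : ∀ {n} (μ : Fin (n ℕ.+ n) → ℚ) → (∀ i → μ (n ↑ʳ i) ≡ μ (i ↑ˡ n)) →
  ∀ u → μ u ≡ dup (λ i → μ (i ↑ˡ n)) u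
dup-unique {n} μ μ≡ u with splitView n n u
... | left i  = sym (dup-↑ˡ _ i)
... | right i = trans (μ≡ i) (sym (dup-↑ʳ _ i))

dup-cube : ∀ {n} (a : Fin n → ℚ) → InHalfOpenCube a → InHalfOpenCube (dup a)
dup-cube {n} a a∈cube u with splitView n n u
... | left i  = subst (λ x → (0ℚ ℚ.≤ x) × (x ℚ.< 1ℚ)) (sym (dup-↑ˡ a i)) (a∈cube i)
... | right i = subst (λ x → (0ℚ ℚ.≤ x) × (x ℚ.< 1ℚ)) (sym (dup-↑ʳ a i)) (a∈cube i)

sumℚ-dup : ∀ {n} (a : Fin n → ℚ) → sumℚ (dup a) ≡ sumℚ a ℚ.+ sumℚ a
sumℚ-dup {n} a = trans (∑-↑ n (dup a)) (cong₂ ℚ._+_ (∑-cong (dup-↑ˡ a)) (∑-cong (dup-↑ʳ a)))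

row : ∀ {r d} → (Fin r → Fin d → ℤ) → Fin r → Point d
row W s m = toℚ (W s m)

indicator : ∀ {m} → Fin m → Fin m → ℚ
indicator i j = if ⌊ j ≟ i ⌋ then 1ℚ else 0ℚ

indicator-comm : ∀ {m} (i j : Fin m) → indicator i j ≡ indicator j i
indicator-comm i j with i ≟ j
... | yes refl = cong (λ b → if b then 1ℚ else 0ℚ) (⌊≟⌋-refl i)
... | no i≢j   = cong (λ b → if b then 1ℚ else 0ℚ) (⌊≟⌋-≢ (i≢j ∘ sym))

indicator-nonNeg : ∀ {m} (i j : Fin m) → 0ℚ ℚ.≤ indicator i j
indicator-nonNeg i j with ⌊ j ≟ i ⌋
... | true  = ℚP.nonNegative⁻¹ 1ℚ
... | false = ℚP.≤-refl

sumℚ-indicator-* : ∀ {m} (i : Fin m) (f : Fin m → ℚ) → sumℚ (λ j → indicator i j ℚ.* f j) ≡ f i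
sumℚ-indicator-* i f = begin
  sumℚ (λ j → indicator i j ℚ.* f j)
    ≡⟨ ∑-single i _ (λ j j≢i → trans (cong (λ b → (if b then 1ℚ else 0ℚ) ℚ.* f j) (⌊≟⌋-≢ j≢i)) (ℚP.*-zeroˡ (f j))) ⟩
  indicator i i ℚ.* f i               ≡⟨ cong (λ b → (if b then 1ℚ else 0ℚ) ℚ.* f i) (⌊≟⌋-refl i) ⟩
  1ℚ ℚ.* f i                          ≡⟨ ℚP.*-identityˡ (f i) ⟩
  f i                                 ∎
  where open ≡-Reasoning

sumℚ-indicator : ∀ {m} (i : Fin m) → sumℚ (indicator i) ≡ 1ℚ
sumℚ-indicator i = trans (∑-cong (λ j → sym (ℚP.*-identityʳ (indicator i j)))) (sumℚ-indicator-* i (λ _ → 1ℚ))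

vecMat-cong : ∀ {r c} (M : Fin r → Fin c → ℤ) {μ ν : Fin r → ℚ} → (∀ u → μ u ≡ ν u) →
  ∀ j → vecMat μ M j ≡ vecMat ν M j
vecMat-cong M μ≗ν j = ∑-cong (λ u → cong (ℚ._* toℚ (M u j)) (μ≗ν u))

vecMat-appendOnes-inject₁ : ∀ {r d} (μ : Fin r → ℚ) (V : Fin r → Fin d → ℤ) j →
  vecMat μ (appendOnes V) (inject₁ j) ≡ vecMat μ V j
vecMat-appendOnes-inject₁ μ V j = ∑-cong (λ u → cong (λ z → μ u ℚ.* toℚ z) (snoc-inject₁ (V u) (+ 1) j))

vecMat-appendOnes-last : ∀ {r d} (μ : Fin r → ℚ) (V : Fin r → Fin d → ℤ) →
  vecMat μ (appendOnes V) (fromℕ d) ≡ sumℚ μ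
vecMat-appendOnes-last μ V = ∑-cong (λ u → trans (cong (λ z → μ u ℚ.* toℚ z) (snoc-fromℕ (V u) (+ 1))) (ℚP.*-identityʳ (μ u)))

isLatticePoint-appendOnes : ∀ {r d} (μ : Fin r → ℚ) (V : Fin r → Fin d → ℤ) →
  IsLatticePoint (vecMat μ (appendOnes V)) ⇔ (IsLatticePoint (vecMat μ V) × IsInteger (sumℚ μ))
isLatticePoint-appendOnes {d = d} μ V = mk⇔
  (λ lat → (λ j → subst IsInteger (vecMat-appendOnes-inject₁ μ V j) (lat (inject₁ j)))
         , subst IsInteger (vecMat-appendOnes-last μ V) (lat (fromℕ d)))
  (λ (latV , int) j → lattice latV int j (view j))
  where
  lattice : IsLatticePoint (vecMat μ V) → IsInteger (sumℚ μ) → ∀ j → View j → IsInteger (vecMat μ (appendOnes V) j)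
  lattice _    int _ ‵fromℕ        = subst IsInteger (sym (vecMat-appendOnes-last μ V)) int
  lattice latV _   _ (‵inject₁ j) = subst IsInteger (sym (vecMat-appendOnes-inject₁ μ V j)) (latV j)

dot-comm : ∀ {d} (x y : Point d) → dot x y ≡ dot y x
dot-comm x y = ∑-cong (λ m → ℚP.*-comm (x m) (y m))

dot-∑ : ∀ {r d} (β : Fin r → ℚ) (z : Fin r → Point d) (x : Point d) →
  dot (λ m → sumℚ (λ l → β l ℚ.* z l m)) x ≡ sumℚ (λ l → β l ℚ.* dot (z l) x)
dot-∑ β z x = begin
  sumℚ (λ m → sumℚ (λ l → β l ℚ.* z l m) ℚ.* x m)
    ≡⟨ ∑-cong (λ m → sym (∑-*ʳ (x m) (λ l → β l ℚ.* z l m))) ⟩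
  sumℚ (λ m → sumℚ (λ l → β l ℚ.* z l m ℚ.* x m))        ≡⟨ ∑-comm (λ m l → β l ℚ.* z l m ℚ.* x m) ⟩
  sumℚ (λ l → sumℚ (λ m → β l ℚ.* z l m ℚ.* x m))
    ≡⟨ ∑-cong (λ l → trans (∑-cong (λ m → ℚP.*-assoc (β l) (z l m) (x m)))
                           (∑-*ˡ (β l) (λ m → z l m ℚ.* x m))) ⟩
  sumℚ (λ l → β l ℚ.* dot (z l) x)                        ∎
  where open ≡-Reasoning

sumℚ-*-if-≟ : ∀ {m} (i : Fin m) (μ : Fin m → ℚ) c →
  sumℚ (λ j → μ j ℚ.* toℚ (if ⌊ j ≟ i ⌋ then c else + 0)) ≡ μ i ℚ.* toℚ c
sumℚ-*-if-≟ i μ c = trans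
  (∑-single i _ (λ j j≢i → trans (cong (λ b → μ j ℚ.* toℚ (if b then c else + 0)) (⌊≟⌋-≢ j≢i)) (ℚP.*-zeroʳ (μ j))))
  (cong (λ b → μ i ℚ.* toℚ (if b then c else + 0)) (⌊≟⌋-refl i))

row∈conv : ∀ {r d} (W : Fin r → Fin d → ℤ) (q : Fin r) → InConv W (row W q)
row∈conv W q = indicator q , indicator-nonNeg q
             , sumℚ-indicator q
             , (λ m → sym (sumℚ-indicator-* q (λ s → row W s m)))

inDual⇒dot-row≤1 : ∀ {r d} (W : Fin r → Fin d → ℤ) {y} → InDual W y → ∀ s → dot (row W s) y ℚ.≤ 1ℚ
inDual⇒dot-row≤1 W y∈P* s = y∈P* (row W s) (row∈conv W s)

dot-row≤1⇒inDual : ∀ {r d} (W : Fin r → Fin d → ℤ) {y} → (∀ s → dot (row W s) y ℚ.≤ 1ℚ) → InDual W y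
dot-row≤1⇒inDual W {y} ≤1 x (μ , μ≥0 , Σμ≡1 , x≡μW) = begin
  dot x y                               ≡⟨ ∑-cong (λ m → cong (ℚ._* y m) (x≡μW m)) ⟩
  dot (vecMat μ W) y                    ≡⟨ dot-∑ μ (row W) y ⟩
  sumℚ (λ s → μ s ℚ.* dot (row W s) y)
    ≤⟨ sumℚ-mono-≤ (λ s → ℚP.*-monoˡ-≤-nonNeg (μ s) {{ℚ.nonNegative (μ≥0 s)}} (≤1 s)) ⟩
  sumℚ (λ s → μ s ℚ.* 1ℚ)
    ≡⟨ trans (∑-cong {f = λ s → μ s ℚ.* 1ℚ} (λ s → ℚP.*-identityʳ (μ s))) Σμ≡1 ⟩
  1ℚ                                    ∎
  where open ℚP.≤-Reasoning

-- y is a convex combination of the lattice vertices u_q of the dual; an inequality ⟨W_s, ·⟩ ≤ 1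
-- tight at y is then tight at every u_q of positive weight.
saturating-latticePoint : ∀ {r d} (W : Fin r → Fin d → ℤ) → IsLatticePolytope (InDual W) →
  ∀ {y} → InDual W y →
  Σ (Point d) λ w → IsLatticePoint w × (∀ s → dot (row W s) y ≡ 1ℚ → dot (row W s) w ≡ 1ℚ)
saturating-latticePoint W (m , U , P*⇔convU) {y} y∈P* = tight (Equivalence.to (P*⇔convU y) y∈P*)
  where
  tight : InConv U y → Σ (Point _) λ w → IsLatticePoint w × (∀ s → dot (row W s) y ≡ 1ℚ → dot (row W s) w ≡ 1ℚ)
  tight (ν , ν≥0 , Σν≡1 , y≡νU) = row U q , (λ j → U q j , refl) , saturated
    where
    t : _ → Fin m → ℚ
    t s q = dot (row W s) (row U q)

    t≤1 : ∀ s q → t s q ℚ.≤ 1ℚ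
    t≤1 s q = inDual⇒dot-row≤1 W (Equivalence.from (P*⇔convU (row U q)) (row∈conv U q)) s

    q-positive : Σ (Fin m) λ q → ν q ≢ 0ℚ
    q-positive = FinP.¬∀⟶∃¬ m (λ q → ν q ≡ 0ℚ) (λ q → ν q ℚP.≟ 0ℚ)
      (λ ν≡0 → ℚP.1≢0 (trans (sym Σν≡1) (trans (∑-cong ν≡0) (∑-0 m))))
    q = proj₁ q-positive

    dot-y : ∀ s → dot (row W s) y ≡ sumℚ (λ q → ν q ℚ.* t s q)
    dot-y s = begin
      dot (row W s) y                                ≡⟨ ∑-cong (λ j → cong (row W s j ℚ.*_) (y≡νU j)) ⟩
      dot (row W s) (vecMat ν U)                     ≡⟨ dot-comm (row W s) (vecMat ν U) ⟩
      dot (vecMat ν U) (row W s)                     ≡⟨ dot-∑ ν (row U) (row W s) ⟩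
      sumℚ (λ q → ν q ℚ.* dot (row U q) (row W s))
        ≡⟨ ∑-cong (λ q → cong (ν q ℚ.*_) (dot-comm (row U q) (row W s))) ⟩
      sumℚ (λ q → ν q ℚ.* t s q)                     ∎
      where open ≡-Reasoning

    saturated : ∀ s → dot (row W s) y ≡ 1ℚ → t s q ≡ 1ℚ
    saturated s tight-at-y = sym (x∙y⁻¹≈ε⇒x≈y 1ℚ (t s q)
      (*-≡0⇒≡0 (proj₂ q-positive) (sumℚ-nonNeg-≡0 slack≥0 Σslack≡0 q)))
      where
      slack : Fin m → ℚ
      slack q = ν q ℚ.* (1ℚ ℚ.- t s q)
      slack≥0 : ∀ q → 0ℚ ℚ.≤ slack q
      slack≥0 q = *-nonNeg (ν≥0 q) (p≤q⇒0≤q-p (t≤1 s q))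
      Σslack≡0 : sumℚ slack ≡ 0ℚ
      Σslack≡0 = begin
        sumℚ slack
          ≡⟨ ∑-cong (λ q → solve 2 (λ v u → v :* (con 1ℚ :- u) := v :- v :* u) refl (ν q) (t s q)) ⟩
        sumℚ (λ q → ν q ℚ.- ν q ℚ.* t s q)            ≡⟨ ∑-minus ν (λ q → ν q ℚ.* t s q) ⟩
        sumℚ ν ℚ.- sumℚ (λ q → ν q ℚ.* t s q)         ≡⟨ cong₂ ℚ._-_ Σν≡1 (trans (sym (dot-y s)) tight-at-y) ⟩
        1ℚ ℚ.- 1ℚ                                     ≡⟨ ℚP.+-inverseʳ 1ℚ ⟩
        0ℚ                                            ∎
        where open ≡-Reasoning

originInInterior⇒scaled-units : ∀ {r d} (W : Fin r → Fin d → ℤ) → OriginInInterior W →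
  Σ ℚ λ δ → 0ℚ ℚ.< δ × (∀ l → InConv W (λ m → δ ℚ.* indicator l m))
originInInterior⇒scaled-units W (ε , 0<ε , ball⊆conv) = δ , 0<δ , λ l → ball⊆conv _ (small l)
  where
  δ = proj₁ (ℚP.<-dense 0<ε)
  0<δ = proj₁ (proj₂ (ℚP.<-dense 0<ε))
  δ<ε = proj₂ (proj₂ (ℚP.<-dense 0<ε))
  small : ∀ l m → ℚ.∣ δ ℚ.* indicator l m ∣ ℚ.< ε
  small l m with ⌊ m ≟ l ⌋
  ... | true  = subst (ℚ._< ε) (sym (trans (cong ℚ.∣_∣ (ℚP.*-identityʳ δ)) (ℚP.0≤p⇒∣p∣≡p (ℚP.<⇒≤ 0<δ)))) δ<ε
  ... | false = subst (ℚ._< ε) (sym (cong ℚ.∣_∣ (ℚP.*-zeroʳ δ))) 0<ε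

module ZeroColumnSums {k} (V : Fin (suc k) → Fin k → ℤ)
  (columnSum≡0 : ∀ m → sumℤ (λ j → V j m) ≡ + 0)
  (symmetric : ∀ p m → V (inject₁ p) m ≡ V (inject₁ m) p) where

  sum-row≡0 : ∀ m → sumℚ (λ j → row V j m) ≡ 0ℚ
  sum-row≡0 m = trans (sym (toℚ-sum (λ j → V j m))) (cong toℚ (columnSum≡0 m))

  sum-dot-row≡0 : ∀ y → sumℚ (λ j → dot (row V j) y) ≡ 0ℚ
  sum-dot-row≡0 y = begin
    sumℚ (λ j → dot (row V j) y)                ≡⟨ ∑-comm (λ j m → row V j m ℚ.* y m) ⟩
    sumℚ (λ m → sumℚ (λ j → row V j m ℚ.* y m))
      ≡⟨ ∑-cong (λ m → trans (∑-*ʳ (y m) (λ j → row V j m)) (trans (cong (ℚ._* y m) (sum-row≡0 m)) (ℚP.*-zeroˡ (y m)))) ⟩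
    sumℚ {k} (λ _ → 0ℚ)                         ≡⟨ ∑-0 k ⟩
    0ℚ                                          ∎
    where open ≡-Reasoning

  vecMat-shift : ∀ a c m → vecMat (λ j → a j ℚ.+ c) V m ≡ vecMat a V m
  vecMat-shift a c m = begin
    vecMat (λ j → a j ℚ.+ c) V m
      ≡⟨ ∑-cong (λ j → ℚP.*-distribʳ-+ (row V j m) (a j) c) ⟩
    sumℚ (λ j → a j ℚ.* row V j m ℚ.+ c ℚ.* row V j m)
      ≡⟨ ∑-+ (λ j → a j ℚ.* row V j m) (λ j → c ℚ.* row V j m) ⟩
    vecMat a V m ℚ.+ sumℚ (λ j → c ℚ.* row V j m)
      ≡⟨ cong (vecMat a V m ℚ.+_) (trans (∑-*ˡ c (λ j → row V j m)) (cong (c ℚ.*_) (sum-row≡0 m))) ⟩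
    vecMat a V m ℚ.+ c ℚ.* 0ℚ
      ≡⟨ solve 2 (λ x c → x :+ c :* con 0ℚ := x) refl (vecMat a V m) c ⟩
    vecMat a V m                                              ∎
    where open ≡-Reasoning

  reduce : (Fin (suc k) → ℚ) → Point k
  reduce c m = c (inject₁ m) ℚ.- c (fromℕ k)

  -- The last row is minus the sum of the others, and the leading block is symmetric.
  vecMat≡dot-reduce : ∀ c p → vecMat c V p ≡ dot (row V (inject₁ p)) (reduce c)
  vecMat≡dot-reduce c p = begin
    vecMat c V p
      ≡⟨ ∑-init-last (λ j → c j ℚ.* row V j p) ⟩
    sumℚ (λ m → c (inject₁ m) ℚ.* r m) ℚ.+ cₗ ℚ.* row V (fromℕ k) p
      ≡⟨ cong (λ x → sumℚ (λ m → c (inject₁ m) ℚ.* r m) ℚ.+ cₗ ℚ.* x) lastRow ⟩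
    sumℚ (λ m → c (inject₁ m) ℚ.* r m) ℚ.+ cₗ ℚ.* (ℚ.- sumℚ r)
      ≡⟨ cong (λ x → sumℚ (λ m → c (inject₁ m) ℚ.* r m) ℚ.+ x)
              (trans (cong ℚ.-_ (∑-*ˡ cₗ r)) (ℚP.neg-distribʳ-* cₗ (sumℚ r))) ⟨
    sumℚ (λ m → c (inject₁ m) ℚ.* r m) ℚ.- sumℚ (λ m → cₗ ℚ.* r m)
      ≡⟨ ∑-minus (λ m → c (inject₁ m) ℚ.* r m) (λ m → cₗ ℚ.* r m) ⟨
    sumℚ (λ m → c (inject₁ m) ℚ.* r m ℚ.- cₗ ℚ.* r m)
      ≡⟨ ∑-cong (λ m → solve 3 (λ x y z → x :* z :- y :* z := z :* (x :- y)) refl (c (inject₁ m)) cₗ (r m)) ⟩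
    sumℚ (λ m → r m ℚ.* reduce c m)
      ≡⟨ ∑-cong (λ m → cong (λ z → toℚ z ℚ.* reduce c m) (symmetric m p)) ⟩
    dot (row V (inject₁ p)) (reduce c)                                    ∎
    where
    open ≡-Reasoning
    cₗ = c (fromℕ k)
    r : Point k
    r m = row V (inject₁ m) p
    lastRow : row V (fromℕ k) p ≡ ℚ.- sumℚ r
    lastRow = trans (last≡sum-sumInit (λ j → row V j p)) (trans (cong (ℚ._- sumℚ r) (sum-row≡0 p)) (ℚP.+-identityˡ (ℚ.- sumℚ r)))

  -- For δ > 0 small, δ eₗ ∈ conv V gives coefficients c with δ eₗ = c V; by vecMat≡dot-reduce
  -- the vectors reduce c then form, up to the factor δ, the basis dual to the leading rows of V.
  originInInterior⇒dualBasis : OriginInInterior V → Σ ℚ λ δ → 0ℚ ℚ.< δ ×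
    Σ (Fin k → Point k) λ D → ∀ l p → dot (D l) (row V (inject₁ p)) ≡ δ ℚ.* indicator p l
  originInInterior⇒dualBasis interior = δ , 0<δ , D , dot-D
    where
    δ = proj₁ (originInInterior⇒scaled-units V interior)
    0<δ = proj₁ (proj₂ (originInInterior⇒scaled-units V interior))
    units = proj₂ (proj₂ (originInInterior⇒scaled-units V interior))

    D : Fin k → Point k
    D l = reduce (proj₁ (units l))

    dot-D : ∀ l p → dot (D l) (row V (inject₁ p)) ≡ δ ℚ.* indicator p l
    dot-D l p = begin
      dot (D l) (row V (inject₁ p))       ≡⟨ dot-comm (D l) (row V (inject₁ p)) ⟩
      dot (row V (inject₁ p)) (D l)       ≡⟨ vecMat≡dot-reduce (proj₁ (units l)) p ⟨
      vecMat (proj₁ (units l)) V p        ≡⟨ proj₂ (proj₂ (proj₂ (units l))) p ⟨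
      δ ℚ.* indicator l p                 ≡⟨ cong (δ ℚ.*_) (indicator-comm l p) ⟩
      δ ℚ.* indicator p l                 ∎
      where open ≡-Reasoning

  dot-rows-onto : OriginInInterior V → ∀ b → sumℚ b ≡ 0ℚ → Σ (Point k) λ y → ∀ j → dot (row V j) y ≡ b j
  dot-rows-onto interior b Σb≡0 = y , dot-y
    where
    δ = proj₁ (originInInterior⇒dualBasis interior)
    0<δ = proj₁ (proj₂ (originInInterior⇒dualBasis interior))
    D = proj₁ (proj₂ (proj₂ (originInInterior⇒dualBasis interior)))
    dot-D = proj₂ (proj₂ (proj₂ (originInInterior⇒dualBasis interior)))
    instance _ = ℚ.>-nonZero 0<δ

    β : Fin k → ℚ
    β l = b (inject₁ l) ℚ.* ℚ.1/ δ

    y : Point k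
    y m = sumℚ (λ l → β l ℚ.* D l m)

    dot-init : ∀ p → dot (row V (inject₁ p)) y ≡ b (inject₁ p)
    dot-init p = begin
      dot (row V (inject₁ p)) y                           ≡⟨ dot-comm (row V (inject₁ p)) y ⟩
      dot y (row V (inject₁ p))                           ≡⟨ dot-∑ β D (row V (inject₁ p)) ⟩
      sumℚ (λ l → β l ℚ.* dot (D l) (row V (inject₁ p)))
        ≡⟨ ∑-cong (λ l → trans (cong (β l ℚ.*_) (dot-D l p))
                               (solve 3 (λ x d e → x :* (d :* e) := e :* (x :* d)) refl (β l) δ (indicator p l))) ⟩
      sumℚ (λ l → indicator p l ℚ.* (β l ℚ.* δ))          ≡⟨ sumℚ-indicator-* p (λ l → β l ℚ.* δ) ⟩
      b (inject₁ p) ℚ.* ℚ.1/ δ ℚ.* δ                      ≡⟨ ℚP.*-assoc (b (inject₁ p)) (ℚ.1/ δ) δ ⟩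
      b (inject₁ p) ℚ.* (ℚ.1/ δ ℚ.* δ)                    ≡⟨ cong (b (inject₁ p) ℚ.*_) (ℚP.*-inverseˡ δ) ⟩
      b (inject₁ p) ℚ.* 1ℚ                                ≡⟨ ℚP.*-identityʳ (b (inject₁ p)) ⟩
      b (inject₁ p)                                       ∎
      where open ≡-Reasoning

    dot-y : ∀ j → dot (row V j) y ≡ b j
    dot-y j with view j
    ... | ‵inject₁ p = dot-init p
    ... | ‵fromℕ     = ≗-init⇒≡-last {f = λ j → dot (row V j) y} {b} (trans (sum-dot-row≡0 y) (sym Σb≡0)) dot-init

  -- The facet normal y with ⟨V_j, y⟩ = 1 for j ≠ i lies in the dual, hence so does a lattice point
  -- w tight on the same rows; pairing a·V with w gives ∑a − n aᵢ.
  reflexive⇒isInteger[∑a-n*aᵢ] : Reflexive V → ∀ i (a : Fin (suc k) → ℚ) → IsLatticePoint (vecMat a V) →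
    IsInteger (sumℚ a ℚ.- toℚ (+ suc k) ℚ.* a i)
  reflexive⇒isInteger[∑a-n*aᵢ] (interior , dual-lattice) i a aV-lattice =
    subst IsInteger (trans (dot-∑ a (row V) w) ∑at≡) (isInteger-sum (λ m → isInteger-* (aV-lattice m) (w-lattice m)))
    where
    N = toℚ (+ suc k)
    b : Fin (suc k) → ℚ
    b j = 1ℚ ℚ.- N ℚ.* indicator i j
    b≡1 : ∀ j → j ≢ i → b j ≡ 1ℚ
    b≡1 j j≢i = trans (cong (λ x → 1ℚ ℚ.- N ℚ.* (if x then 1ℚ else 0ℚ)) (⌊≟⌋-≢ j≢i))
                      (solve 1 (λ n → con 1ℚ :- n :* con 0ℚ := con 1ℚ) refl N)
    b≤1 : ∀ j → b j ℚ.≤ 1ℚ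
    b≤1 j = subst (b j ℚ.≤_) (ℚP.+-identityʳ 1ℚ) (ℚP.+-monoʳ-≤ 1ℚ (ℚP.neg-antimono-≤
              (*-nonNeg (toℚ-mono-≤ {+ 0} {+ suc k} (ℤ.+≤+ ℕ.z≤n)) (indicator-nonNeg i j))))
    Σb≡0 : sumℚ b ≡ 0ℚ
    Σb≡0 = begin
      sumℚ b                                          ≡⟨ ∑-minus {suc k} (λ _ → 1ℚ) (λ j → N ℚ.* indicator i j) ⟩
      sumℚ {suc k} (λ _ → 1ℚ) ℚ.- sumℚ (λ j → N ℚ.* indicator i j)
        ≡⟨ cong₂ ℚ._-_ (sumℚ-const-1 (suc k)) (trans (∑-*ˡ N (indicator i)) (cong (N ℚ.*_) (sumℚ-indicator i))) ⟩
      N ℚ.- N ℚ.* 1ℚ                                  ≡⟨ solve 1 (λ n → n :- n :* con 1ℚ := con 0ℚ) refl N ⟩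
      0ℚ                                              ∎
      where open ≡-Reasoning
    y = proj₁ (dot-rows-onto interior b Σb≡0)
    dot-y = proj₂ (dot-rows-onto interior b Σb≡0)
    y∈P* : InDual V y
    y∈P* = dot-row≤1⇒inDual V (λ j → subst (ℚ._≤ 1ℚ) (sym (dot-y j)) (b≤1 j))
    w = proj₁ (saturating-latticePoint V dual-lattice y∈P*)
    w-lattice = proj₁ (proj₂ (saturating-latticePoint V dual-lattice y∈P*))
    w-tight = proj₂ (proj₂ (saturating-latticePoint V dual-lattice y∈P*))
    ∑at≡ : sumℚ (λ j → a j ℚ.* dot (row V j) w) ≡ sumℚ a ℚ.- N ℚ.* a i
    ∑at≡ = trans (sumℚ-*-ones-but-one i a (λ j → dot (row V j) w) (λ j j≢i → w-tight j (trans (dot-y j) (b≡1 j j≢i))) (sum-dot-row≡0 w))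
                 (cong (λ x → sumℚ a ℚ.- x ℚ.* a i) (sumℚ-const-1 (suc k)))

count edgeWeight : Bool → ℤ
count b = if b then + 1 else + 0
edgeWeight b = if b then ℤ.-1ℤ else + 0

laplacian-diag : ∀ {m} (a : Fin m → Fin m → Bool) x → laplacian a x x ≡ degree a x
laplacian-diag a x = cong (λ b → if b then degree a x else edgeWeight (a x x)) (⌊≟⌋-refl x)

laplacian-offDiag : ∀ {m} (a : Fin m → Fin m → Bool) {x y} → x ≢ y → laplacian a x y ≡ edgeWeight (a x y)
laplacian-offDiag a {x} {y} x≢y = cong (λ b → if b then degree a x else edgeWeight (a x y)) (⌊≟⌋-≢ x≢y)

module _ {m} (G : SimpleGraph m) where

  laplacian-sym : ∀ x y → laplacian (adj G) x y ≡ laplacian (adj G) y x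
  laplacian-sym x y with x ≟ y
  ... | yes refl = sym (laplacian-diag (adj G) x)
  ... | no x≢y   = trans (cong edgeWeight (SimpleGraph.sym G x y)) (sym (laplacian-offDiag (adj G) (x≢y ∘ sym)))

  laplacian-split : ∀ r c →
    laplacian (adj G) r c ≡ (if ⌊ r ≟ c ⌋ then degree (adj G) c else + 0) ℤ.+ ℤ.- count (adj G c r)
  laplacian-split r c with r ≟ c
  ... | yes refl rewrite irrefl G r = sym (ℤP.+-identityʳ _)
  ... | no _     rewrite SimpleGraph.sym G c r with adj G r c
  ...   | true  = refl
  ...   | false = refl

  laplacian-columnSum≡0 : ∀ c → sumℤ (λ r → laplacian (adj G) r c) ≡ + 0
  laplacian-columnSum≡0 c = begin
    sumℤ (λ r → laplacian (adj G) r c)      ≡⟨ Sumℤ.∑-cong (λ r → laplacian-split r c) ⟩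
    sumℤ (λ r → diag r ℤ.+ ℤ.- adjacent r)  ≡⟨ Sumℤ.∑-minus diag adjacent ⟩
    sumℤ diag ℤ.- d                         ≡⟨ cong (ℤ._- d) (Sumℤ.∑-single c diag (λ r r≢c → cong (λ b → if b then d else + 0) (⌊≟⌋-≢ r≢c))) ⟩
    diag c ℤ.- d                            ≡⟨ cong (λ b → (if b then d else + 0) ℤ.- d) (⌊≟⌋-refl c) ⟩
    d ℤ.- d                                 ≡⟨ ℤP.+-inverseʳ d ⟩
    + 0                                     ∎
    where
    open ≡-Reasoning
    d = degree (adj G) c
    diag adjacent : Fin m → ℤ
    diag r = if ⌊ r ≟ c ⌋ then d else + 0
    adjacent r = count (adj G c r)

module _ {k} (G : SimpleGraph (suc k)) where

  laplacianSimplex-columnSum≡0 : ∀ m → sumℤ (λ j → laplacianSimplex G j m) ≡ + 0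
  laplacianSimplex-columnSum≡0 m = laplacian-columnSum≡0 G (punchIn (fromℕ k) m)

  laplacianSimplex-symmetric : ∀ p m → laplacianSimplex G (inject₁ p) m ≡ laplacianSimplex G (inject₁ m) p
  laplacianSimplex-symmetric p m = begin
    laplacian (adj G) (inject₁ p) (punchIn (fromℕ k) m)
      ≡⟨ cong (laplacian (adj G) (inject₁ p)) (punchIn-fromℕ k m) ⟩
    laplacian (adj G) (inject₁ p) (inject₁ m)            ≡⟨ laplacian-sym G (inject₁ p) (inject₁ m) ⟩
    laplacian (adj G) (inject₁ m) (inject₁ p)
      ≡⟨ cong (laplacian (adj G) (inject₁ m)) (punchIn-fromℕ k p) ⟨
    laplacian (adj G) (inject₁ m) (punchIn (fromℕ k) p)  ∎
    where open ≡-Reasoning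

module Whiskered {n} (G : SimpleGraph n) where

  private
    W = whiskeredAdj G
    L = laplacian W

  W-↑ˡ-↑ˡ : ∀ i j → W (i ↑ˡ n) (j ↑ˡ n) ≡ adj G i j
  W-↑ˡ-↑ˡ i j rewrite FinP.splitAt-↑ˡ n i n | FinP.splitAt-↑ˡ n j n = refl

  W-↑ˡ-↑ʳ : ∀ i j → W (i ↑ˡ n) (n ↑ʳ j) ≡ ⌊ i ≟ j ⌋
  W-↑ˡ-↑ʳ i j rewrite FinP.splitAt-↑ˡ n i n | FinP.splitAt-↑ʳ n n j = refl

  W-↑ʳ-↑ˡ : ∀ i j → W (n ↑ʳ i) (j ↑ˡ n) ≡ ⌊ i ≟ j ⌋
  W-↑ʳ-↑ˡ i j rewrite FinP.splitAt-↑ʳ n n i | FinP.splitAt-↑ˡ n j n = refl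

  W-↑ʳ-↑ʳ : ∀ i j → W (n ↑ʳ i) (n ↑ʳ j) ≡ false
  W-↑ʳ-↑ʳ i j rewrite FinP.splitAt-↑ʳ n n i | FinP.splitAt-↑ʳ n n j = refl

  private
    count-≟ : ∀ (i : Fin n) → sumℤ (λ j → count ⌊ i ≟ j ⌋) ≡ + 1
    count-≟ i = trans (Sumℤ.∑-single i _ (λ j j≢i → cong count (⌊≟⌋-≢ (j≢i ∘ sym)))) (cong count (⌊≟⌋-refl i))

  degree-↑ˡ : ∀ i → degree W (i ↑ˡ n) ≡ degree (adj G) i ℤ.+ + 1
  degree-↑ˡ i = trans (Sumℤ.∑-↑ n {n} _) (cong₂ ℤ._+_
    (Sumℤ.∑-cong (λ j → cong count (W-↑ˡ-↑ˡ i j)))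
    (trans (Sumℤ.∑-cong (λ j → cong count (W-↑ˡ-↑ʳ i j))) (count-≟ i)))

  degree-↑ʳ : ∀ i → degree W (n ↑ʳ i) ≡ + 1
  degree-↑ʳ i = trans (Sumℤ.∑-↑ n {n} _) (cong₂ ℤ._+_
    (trans (Sumℤ.∑-cong (λ j → cong count (W-↑ʳ-↑ˡ i j))) (count-≟ i))
    (trans (Sumℤ.∑-cong (λ j → cong count (W-↑ʳ-↑ʳ i j))) (Sumℤ.∑-0 n)))

  L-↑ˡ-↑ˡ+L-↑ʳ-↑ˡ : ∀ i j → L (i ↑ˡ n) (j ↑ˡ n) ℤ.+ L (n ↑ʳ i) (j ↑ˡ n) ≡ laplacian (adj G) i j
  L-↑ˡ-↑ˡ+L-↑ʳ-↑ˡ i j with i ≟ j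
  ... | yes refl = begin
    L (i ↑ˡ n) (i ↑ˡ n) ℤ.+ L (n ↑ʳ i) (i ↑ˡ n)
      ≡⟨ cong₂ ℤ._+_ (trans (laplacian-diag W (i ↑ˡ n)) (degree-↑ˡ i))
                     (trans (laplacian-offDiag W (↑ˡ≢↑ʳ n i i ∘ sym)) (cong edgeWeight (trans (W-↑ʳ-↑ˡ i i) (⌊≟⌋-refl i)))) ⟩
    degree (adj G) i ℤ.+ + 1 ℤ.+ ℤ.-1ℤ
      ≡⟨ trans (ℤP.+-assoc (degree (adj G) i) (+ 1) ℤ.-1ℤ) (ℤP.+-identityʳ (degree (adj G) i)) ⟩
    degree (adj G) i                    ∎
    where open ≡-Reasoning
  ... | no i≢j = begin
    L (i ↑ˡ n) (j ↑ˡ n) ℤ.+ L (n ↑ʳ i) (j ↑ˡ n)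
      ≡⟨ cong₂ ℤ._+_ (trans (laplacian-offDiag W (i≢j ∘ FinP.↑ˡ-injective n i j)) (cong edgeWeight (W-↑ˡ-↑ˡ i j)))
                     (trans (laplacian-offDiag W (↑ˡ≢↑ʳ n j i ∘ sym)) (cong edgeWeight (trans (W-↑ʳ-↑ˡ i j) (⌊≟⌋-≢ i≢j)))) ⟩
    edgeWeight (adj G i j) ℤ.+ + 0  ≡⟨ ℤP.+-identityʳ _ ⟩
    edgeWeight (adj G i j)           ∎
    where open ≡-Reasoning

  L-↑ˡ-↑ʳ : ∀ i j → L (i ↑ˡ n) (n ↑ʳ j) ≡ edgeWeight ⌊ i ≟ j ⌋
  L-↑ˡ-↑ʳ i j = trans (laplacian-offDiag W (↑ˡ≢↑ʳ n i j)) (cong edgeWeight (W-↑ˡ-↑ʳ i j))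

  L-↑ʳ-↑ʳ : ∀ i j → L (n ↑ʳ i) (n ↑ʳ j) ≡ count ⌊ i ≟ j ⌋
  L-↑ʳ-↑ʳ i j with i ≟ j
  ... | yes refl = trans (laplacian-diag W (n ↑ʳ i)) (degree-↑ʳ i)
  ... | no i≢j   = trans (laplacian-offDiag W (i≢j ∘ FinP.↑ʳ-injective n i j)) (cong edgeWeight (W-↑ʳ-↑ʳ i j))

module WhiskeredLaplacian {k} (G : SimpleGraph (suc k)) where

  private
    n = suc k
    L = laplacian (whiskeredAdj G)
    Lₙ = deleteCol L (fromℕ k ↑ˡ n)
  open Whiskered G

  vecMat-whisker : ∀ μ i → vecMat μ (appendOnes Lₙ) (inject₁ (k ↑ʳ i)) ≡ μ (n ↑ʳ i) ℚ.- μ (i ↑ˡ n)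
  vecMat-whisker μ i = begin
    vecMat μ (appendOnes Lₙ) (inject₁ (k ↑ʳ i))      ≡⟨ vecMat-appendOnes-inject₁ μ Lₙ (k ↑ʳ i) ⟩
    vecMat μ Lₙ (k ↑ʳ i)
      ≡⟨ ∑-cong (λ u → cong (λ c → μ u ℚ.* toℚ (L u c)) (punchIn-fromℕ↑ˡ-↑ʳ k n i)) ⟩
    sumℚ {n ℕ.+ n} (λ u → μ u ℚ.* toℚ (L u (n ↑ʳ i)))
      ≡⟨ ∑-↑ n {n} (λ u → μ u ℚ.* toℚ (L u (n ↑ʳ i))) ⟩
    sumℚ {n} (λ j → μ (j ↑ˡ n) ℚ.* toℚ (L (j ↑ˡ n) (n ↑ʳ i))) ℚ.+ sumℚ {n} (λ j → μ (n ↑ʳ j) ℚ.* toℚ (L (n ↑ʳ j) (n ↑ʳ i)))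
      ≡⟨ cong₂ ℚ._+_ (trans (∑-cong (λ j → cong (λ z → μ (j ↑ˡ n) ℚ.* toℚ z) (L-↑ˡ-↑ʳ j i))) (sumℚ-*-if-≟ i (λ j → μ (j ↑ˡ n)) ℤ.-1ℤ))
                     (trans (∑-cong (λ j → cong (λ z → μ (n ↑ʳ j) ℚ.* toℚ z) (L-↑ʳ-↑ʳ j i))) (sumℚ-*-if-≟ i (λ j → μ (n ↑ʳ j)) (+ 1))) ⟩
    μ (i ↑ˡ n) ℚ.* toℚ ℤ.-1ℤ ℚ.+ μ (n ↑ʳ i) ℚ.* toℚ (+ 1)
      ≡⟨ solve 2 (λ x y → x :* con (toℚ ℤ.-1ℤ) :+ y :* con (toℚ (+ 1)) := y :- x) refl (μ (i ↑ˡ n)) (μ (n ↑ʳ i)) ⟩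
    μ (n ↑ʳ i) ℚ.- μ (i ↑ˡ n)                          ∎
    where open ≡-Reasoning

  vecMat-dup-graph : ∀ a j → vecMat (dup a) (appendOnes Lₙ) (inject₁ (j ↑ˡ n)) ≡ vecMat a (laplacianSimplex G) j
  vecMat-dup-graph a j = begin
    vecMat (dup a) (appendOnes Lₙ) (inject₁ (j ↑ˡ n))  ≡⟨ vecMat-appendOnes-inject₁ (dup a) Lₙ (j ↑ˡ n) ⟩
    vecMat (dup a) Lₙ (j ↑ˡ n)
      ≡⟨ ∑-cong (λ u → cong (λ c → dup a u ℚ.* toℚ (L u c)) (punchIn-↑ˡ (fromℕ k) j n)) ⟩
    sumℚ {n ℕ.+ n} (λ u → dup a u ℚ.* toℚ (L u (c ↑ˡ n)))
      ≡⟨ ∑-↑ n {n} (λ u → dup a u ℚ.* toℚ (L u (c ↑ˡ n))) ⟩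
    sumℚ {n} (λ i → dup a (i ↑ˡ n) ℚ.* toℚ (L (i ↑ˡ n) (c ↑ˡ n))) ℚ.+ sumℚ (λ i → dup a (n ↑ʳ i) ℚ.* toℚ (L (n ↑ʳ i) (c ↑ˡ n)))
      ≡⟨ cong₂ ℚ._+_ (∑-cong (λ i → cong (ℚ._* toℚ (L (i ↑ˡ n) (c ↑ˡ n))) (dup-↑ˡ a i)))
                     (∑-cong (λ i → cong (ℚ._* toℚ (L (n ↑ʳ i) (c ↑ˡ n))) (dup-↑ʳ a i))) ⟩
    sumℚ {n} (λ i → a i ℚ.* toℚ (L (i ↑ˡ n) (c ↑ˡ n))) ℚ.+ sumℚ (λ i → a i ℚ.* toℚ (L (n ↑ʳ i) (c ↑ˡ n)))
      ≡⟨ ∑-+ (λ i → a i ℚ.* toℚ (L (i ↑ˡ n) (c ↑ˡ n))) (λ i → a i ℚ.* toℚ (L (n ↑ʳ i) (c ↑ˡ n))) ⟨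
    sumℚ (λ i → a i ℚ.* toℚ (L (i ↑ˡ n) (c ↑ˡ n)) ℚ.+ a i ℚ.* toℚ (L (n ↑ʳ i) (c ↑ˡ n)))
      ≡⟨ ∑-cong (λ i → trans (sym (ℚP.*-distribˡ-+ (a i) (toℚ (L (i ↑ˡ n) (c ↑ˡ n))) (toℚ (L (n ↑ʳ i) (c ↑ˡ n)))))
                             (cong (a i ℚ.*_) (trans (sym (toℚ-+ (L (i ↑ˡ n) (c ↑ˡ n)) (L (n ↑ʳ i) (c ↑ˡ n))))
                                                     (cong toℚ (L-↑ˡ-↑ˡ+L-↑ʳ-↑ˡ i c))))) ⟩
    vecMat a (laplacianSimplex G) j                    ∎
    where
    open ≡-Reasoning
    c = punchIn (fromℕ k) j

module WhiskeredLatticePoints {k} (G : SimpleGraph (suc k))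
  (congruence : ∀ i (a : Fin (suc k) → ℚ) → IsLatticePoint (vecMat a (laplacianSimplex G)) →
                IsInteger (sumℚ a ℚ.- toℚ (+ suc k) ℚ.* a i)) where

  private
    n = suc k
    V = laplacianSimplex G
    Lₙ = deleteCol (laplacian (whiskeredAdj G)) (fromℕ k ↑ˡ n)
    M = appendOnes Lₙ
    N = toℚ (+ n)
    h = + 1 ℚ./ (n ℕ.+ n)

  open WhiskeredLaplacian G
  open ZeroColumnSums V (laplacianSimplex-columnSum≡0 G) (laplacianSimplex-symmetric G) using (vecMat-shift)

  [N+N]*h≡1 : (N ℚ.+ N) ℚ.* h ≡ 1ℚ
  [N+N]*h≡1 = trans (cong (ℚ._* h) (sym (toℚ-+ (+ n) (+ n)))) (toℚ-*-1/ (k ℕ.+ n))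

  0<N+N : 0ℚ ℚ.< N ℚ.+ N
  0<N+N = subst (0ℚ ℚ.<_) (toℚ-+ (+ n) (+ n)) (toℚ-mono-< {+ 0} {+ (n ℕ.+ n)} (ℤ.+<+ (ℕ.s≤s ℕ.z≤n)))

  instance
    N+N-positive : ℚ.Positive (N ℚ.+ N)
    N+N-positive = ℚ.positive 0<N+N
    N+N-nonNegative : ℚ.NonNegative (N ℚ.+ N)
    N+N-nonNegative = ℚ.nonNegative (ℚP.<⇒≤ 0<N+N)

  0<h : 0ℚ ℚ.< h
  0<h = ℚP.*-cancelˡ-<-nonNeg (N ℚ.+ N) (subst₂ ℚ._<_ (sym (ℚP.*-zeroʳ (N ℚ.+ N))) (sym [N+N]*h≡1) (ℚP.positive⁻¹ 1ℚ))

  -- 2n aᵢ ≡ 2∑a - 2(∑a - n aᵢ) is an odd integer when 2∑a is odd.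
  h≤coordinate : ∀ a → InHalfOpenCube a → IsLatticePoint (vecMat a V) → ∀ q →
    sumℚ a ℚ.+ sumℚ a ≡ toℚ (+ 1 ℤ.+ (q ℤ.+ q)) → ∀ i → h ℚ.≤ a i
  h≤coordinate a a∈cube aV-lattice q 2∑a≡ i = ℚP.*-cancelˡ-≤-pos (N ℚ.+ N) (begin
    (N ℚ.+ N) ℚ.* h                  ≡⟨ [N+N]*h≡1 ⟩
    toℚ (+ 1)
      ≤⟨ toℚ-mono-≤ (odd-nonNeg⇒≥1 v (toℚ-cancel-≤ (subst (0ℚ ℚ.≤_) 2Naᵢ≡ 0≤2Naᵢ))) ⟩
    toℚ (+ 1 ℤ.+ (v ℤ.+ v))          ≡⟨ 2Naᵢ≡ ⟨
    (N ℚ.+ N) ℚ.* a i                ∎)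
    where
    open ℚP.≤-Reasoning
    z = proj₁ (congruence i a aV-lattice)
    v = q ℤ.- z
    0≤2Naᵢ : 0ℚ ℚ.≤ (N ℚ.+ N) ℚ.* a i
    0≤2Naᵢ = *-nonNeg (ℚP.<⇒≤ 0<N+N) (proj₁ (a∈cube i))
    2Naᵢ≡ : (N ℚ.+ N) ℚ.* a i ≡ toℚ (+ 1 ℤ.+ (v ℤ.+ v))
    2Naᵢ≡ = begin-equality
      (N ℚ.+ N) ℚ.* a i
        ≡⟨ solve 3 (λ n x s → (n :+ n) :* x := (s :+ s) :- ((s :- n :* x) :+ (s :- n :* x))) refl N (a i) (sumℚ a) ⟩
      (sumℚ a ℚ.+ sumℚ a) ℚ.- ((sumℚ a ℚ.- N ℚ.* a i) ℚ.+ (sumℚ a ℚ.- N ℚ.* a i))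
        ≡⟨ cong₂ (λ x y → x ℚ.- (y ℚ.+ y)) 2∑a≡ (proj₂ (congruence i a aV-lattice)) ⟩
      toℚ (+ 1 ℤ.+ (q ℤ.+ q)) ℚ.- (toℚ z ℚ.+ toℚ z)
        ≡⟨ trans (cong (λ x → toℚ (+ 1 ℤ.+ (q ℤ.+ q)) ℚ.- x) (sym (toℚ-+ z z))) (sym (toℚ-minus (+ 1 ℤ.+ (q ℤ.+ q)) (z ℤ.+ z))) ⟩
      toℚ ((+ 1 ℤ.+ (q ℤ.+ q)) ℤ.- (z ℤ.+ z))
        ≡⟨ cong toℚ (ℤSolver.solve 2 (λ q z → (ℤSolver.con (+ 1) ℤSolver.:+ (q ℤSolver.:+ q)) ℤSolver.:- (z ℤSolver.:+ z)
                       ℤSolver.:= ℤSolver.con (+ 1) ℤSolver.:+ ((q ℤSolver.:- z) ℤSolver.:+ (q ℤSolver.:- z))) refl q z) ⟩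
      toℚ (+ 1 ℤ.+ (v ℤ.+ v))          ∎

  -- n lᵢ ≡ ∑l - (∑l - n lᵢ) is an integer below n, so 2n lᵢ + 1 < 2n.
  coordinate+h<1 : ∀ l → InHalfOpenCube l → IsLatticePoint (vecMat l V) → IsInteger (sumℚ l) → ∀ i → l i ℚ.+ h ℚ.< 1ℚ
  coordinate+h<1 l l∈cube lV-lattice (s , ∑l≡s) i = ℚP.*-cancelˡ-<-nonNeg (N ℚ.+ N) (begin-strict
    (N ℚ.+ N) ℚ.* (l i ℚ.+ h)
      ≡⟨ solve 3 (λ n x h → (n :+ n) :* (x :+ h) := (n :* x :+ n :* x) :+ (n :+ n) :* h) refl N (l i) h ⟩
    (N ℚ.* l i ℚ.+ N ℚ.* l i) ℚ.+ (N ℚ.+ N) ℚ.* h ≡⟨ cong₂ (λ x y → (x ℚ.+ x) ℚ.+ y) Nlᵢ≡w [N+N]*h≡1 ⟩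
    (toℚ w ℚ.+ toℚ w) ℚ.+ toℚ (+ 1)
      ≡⟨ trans (cong (ℚ._+ toℚ (+ 1)) (sym (toℚ-+ w w))) (sym (toℚ-+ (w ℤ.+ w) (+ 1))) ⟩
    toℚ ((w ℤ.+ w) ℤ.+ + 1)                <⟨ toℚ-mono-< (<⇒odd<even w<n) ⟩
    toℚ (+ n ℤ.+ + n)                      ≡⟨ toℚ-+ (+ n) (+ n) ⟩
    N ℚ.+ N                                ≡⟨ ℚP.*-identityʳ (N ℚ.+ N) ⟨
    (N ℚ.+ N) ℚ.* 1ℚ                       ∎)
    where
    open ℚP.≤-Reasoning
    z = proj₁ (congruence i l lV-lattice)
    w = s ℤ.- z
    Nlᵢ≡w : N ℚ.* l i ≡ toℚ w
    Nlᵢ≡w = begin-equality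
      N ℚ.* l i
        ≡⟨ solve 3 (λ n x s → n :* x := s :- (s :- n :* x)) refl N (l i) (sumℚ l) ⟩
      sumℚ l ℚ.- (sumℚ l ℚ.- N ℚ.* l i)      ≡⟨ cong₂ ℚ._-_ ∑l≡s (proj₂ (congruence i l lV-lattice)) ⟩
      toℚ s ℚ.- toℚ z                        ≡⟨ toℚ-minus s z ⟨
      toℚ w                                  ∎
    w<n : w ℤ.< + n
    w<n = toℚ-cancel-< (subst₂ ℚ._<_ Nlᵢ≡w (ℚP.*-identityʳ N) (ℚP.*-monoʳ-<-pos N {{ℚ.positive N>0}} (proj₂ (l∈cube i))))
      where
      N>0 : 0ℚ ℚ.< N
      N>0 = toℚ-mono-< {+ 0} {+ n} (ℤ.+<+ (ℕ.s≤s ℕ.z≤n))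

  dup-lattice : ∀ a → IsLatticePoint (vecMat a V) → IsInteger (sumℚ a ℚ.+ sumℚ a) → IsLatticePoint (vecMat (dup a) M)
  dup-lattice a aV-lattice 2∑a-integer j = column j (view j)
    where
    column : ∀ j → View j → IsInteger (vecMat (dup a) M j)
    column _ ‵fromℕ        = subst IsInteger (sym (trans (vecMat-appendOnes-last (dup a) Lₙ) (sumℚ-dup a))) 2∑a-integer
    column _ (‵inject₁ c) with splitView k n c
    ... | left j  = subst IsInteger (sym (vecMat-dup-graph a j)) (aV-lattice j)
    ... | right i = + 0 , trans (vecMat-whisker (dup a) i) (trans (cong₂ ℚ._-_ (dup-↑ʳ a i) (dup-↑ˡ a i)) (ℚP.+-inverseʳ (a i)))

  InDoubledΛ : Point (n ℕ.+ n) → Set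
  InDoubledΛ y = Σ (Fin n → ℚ) λ l → InΛ V l ×
    ((∀ j → y j ≡ vecMat (dup l) M j) ⊎ (∀ j → y j ≡ vecMat (λ u → dup l u ℚ.+ h) M j))

  shift-down-InΛ : ∀ a → InHalfOpenCube a → IsLatticePoint (vecMat a V) → ∀ q →
    sumℚ a ℚ.+ sumℚ a ≡ toℚ (+ 1 ℤ.+ (q ℤ.+ q)) → InΛ V (λ i → a i ℚ.- h)
  shift-down-InΛ a a∈cube aV-lattice q 2∑a≡ = l∈cube , Equivalence.from (isLatticePoint-appendOnes l V) (lV-lattice , q , ∑l≡q)
    where
    l : Fin n → ℚ
    l i = a i ℚ.- h
    l∈cube : InHalfOpenCube l
    l∈cube i = p≤q⇒0≤q-p (h≤coordinate a a∈cube aV-lattice q 2∑a≡ i)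
             , ℚP.≤-<-trans (ℚP.+-monoʳ-≤ (a i) (ℚP.neg-antimono-≤ (ℚP.<⇒≤ 0<h))) (subst (ℚ._< 1ℚ) (sym (ℚP.+-identityʳ (a i))) (proj₂ (a∈cube i)))
    lV-lattice : IsLatticePoint (vecMat l V)
    lV-lattice m = subst IsInteger (sym (vecMat-shift a (ℚ.- h) m)) (aV-lattice m)
    ∑l≡q : sumℚ l ≡ toℚ q
    ∑l≡q = x+x≡q+q⇒x≡q (sumℚ l) q (begin
      sumℚ l ℚ.+ sumℚ l
        ≡⟨ cong₂ ℚ._+_ (sumℚ-shift a (ℚ.- h)) (sumℚ-shift a (ℚ.- h)) ⟩
      (sumℚ a ℚ.+ N ℚ.* (ℚ.- h)) ℚ.+ (sumℚ a ℚ.+ N ℚ.* (ℚ.- h))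
        ≡⟨ solve 3 (λ s n h → (s :+ n :* (:- h)) :+ (s :+ n :* (:- h)) := (s :+ s) :- (n :+ n) :* h) refl (sumℚ a) N h ⟩
      (sumℚ a ℚ.+ sumℚ a) ℚ.- (N ℚ.+ N) ℚ.* h                 ≡⟨ cong₂ ℚ._-_ 2∑a≡ [N+N]*h≡1 ⟩
      toℚ (+ 1 ℤ.+ (q ℤ.+ q)) ℚ.- 1ℚ                          ≡⟨ cong (ℚ._- 1ℚ) (toℚ-+ (+ 1) (q ℤ.+ q)) ⟩
      (1ℚ ℚ.+ toℚ (q ℤ.+ q)) ℚ.- 1ℚ
        ≡⟨ solve 1 (λ x → (con 1ℚ :+ x) :- con 1ℚ := x) refl (toℚ (q ℤ.+ q)) ⟩
      toℚ (q ℤ.+ q)                                           ∎)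
      where open ≡-Reasoning

  fundPar⇒InDoubledΛ : ∀ y → IsLatticePoint y × InFundPar Lₙ y → InDoubledΛ y
  fundPar⇒InDoubledΛ y (y-lattice , μ , μ∈cube , y≡μM) = by-parity (parity (proj₁ 2∑a-integer))
    where
    a : Fin n → ℚ
    a i = μ (i ↑ˡ n)

    -- a whisker coordinate of y is μ (n ↑ʳ i) - μ (i ↑ˡ n), an integer in (-1, 1)
    y≡aM : ∀ j → y j ≡ vecMat (dup a) M j
    y≡aM j = trans (y≡μM j) (vecMat-cong M (dup-unique μ λ i → half-open-unique (μ∈cube (i ↑ˡ n)) (μ∈cube (n ↑ʳ i))
               (subst IsInteger (trans (y≡μM _) (vecMat-whisker μ i)) (y-lattice (inject₁ (k ↑ʳ i))))) j)

    aV-lattice : IsLatticePoint (vecMat a V)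
    aV-lattice j = subst IsInteger (trans (y≡aM _) (vecMat-dup-graph a j)) (y-lattice (inject₁ (j ↑ˡ n)))

    2∑a-integer : IsInteger (sumℚ a ℚ.+ sumℚ a)
    2∑a-integer = subst IsInteger (trans (y≡aM _) (trans (vecMat-appendOnes-last (dup a) Lₙ) (sumℚ-dup a))) (y-lattice (fromℕ (k ℕ.+ n)))

    by-parity : Σ ℤ (λ q → (proj₁ 2∑a-integer ≡ q ℤ.+ q) ⊎ (proj₁ 2∑a-integer ≡ + 1 ℤ.+ (q ℤ.+ q))) → InDoubledΛ y
    by-parity (q , inj₁ even) = a , ((λ i → μ∈cube (i ↑ˡ n))
      , Equivalence.from (isLatticePoint-appendOnes a V) (aV-lattice , q , x+x≡q+q⇒x≡q (sumℚ a) q (trans (proj₂ 2∑a-integer) (cong toℚ even))))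
      , inj₁ y≡aM
    by-parity (q , inj₂ odd) = (λ i → a i ℚ.- h)
      , shift-down-InΛ a (λ i → μ∈cube (i ↑ˡ n)) aV-lattice q (trans (proj₂ 2∑a-integer) (cong toℚ odd))
      , inj₂ (λ j → trans (y≡aM j) (vecMat-cong M (λ u → sym (trans (cong (ℚ._+ h) (dup-∘ (ℚ._- h) a u))
                                                             (solve 2 (λ x h → (x :- h) :+ h := x) refl (dup a u) h))) j))

  InDoubledΛ⇒fundPar : ∀ y → InDoubledΛ y → IsLatticePoint y × InFundPar Lₙ y
  InDoubledΛ⇒fundPar y (l , (l∈cube , l-lattice) , inj₁ y≡lM) =
    (λ j → subst IsInteger (sym (y≡lM j)) (dup-lattice l lV-lattice (isInteger-+ ∑l-integer ∑l-integer) j))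
    , dup l , dup-cube l l∈cube , y≡lM
    where
    lV-lattice = proj₁ (Equivalence.to (isLatticePoint-appendOnes l V) l-lattice)
    ∑l-integer = proj₂ (Equivalence.to (isLatticePoint-appendOnes l V) l-lattice)
  InDoubledΛ⇒fundPar y (l , (l∈cube , l-lattice) , inj₂ y≡[l+h]M) =
    (λ j → subst IsInteger (sym (trans (y≡[l+h]M j) (vecMat-cong M dup[l]+h≡dup[a] j))) (dup-lattice a aV-lattice 2∑a-integer j))
    , (λ u → dup l u ℚ.+ h) , (λ u → subst (λ x → (0ℚ ℚ.≤ x) × (x ℚ.< 1ℚ)) (sym (dup[l]+h≡dup[a] u)) (dup-cube a a∈cube u)) , y≡[l+h]M
    where
    lV-lattice = proj₁ (Equivalence.to (isLatticePoint-appendOnes l V) l-lattice)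
    ∑l-integer = proj₂ (Equivalence.to (isLatticePoint-appendOnes l V) l-lattice)
    a : Fin n → ℚ
    a i = l i ℚ.+ h
    dup[l]+h≡dup[a] : ∀ u → dup l u ℚ.+ h ≡ dup a u
    dup[l]+h≡dup[a] u = sym (dup-∘ (ℚ._+ h) l u)
    a∈cube : InHalfOpenCube a
    a∈cube i = ℚP.+-mono-≤ (proj₁ (l∈cube i)) (ℚP.<⇒≤ 0<h) , coordinate+h<1 l l∈cube lV-lattice ∑l-integer i
    aV-lattice : IsLatticePoint (vecMat a V)
    aV-lattice m = subst IsInteger (sym (vecMat-shift l h m)) (lV-lattice m)
    2∑a-integer : IsInteger (sumℚ a ℚ.+ sumℚ a)
    2∑a-integer = subst IsInteger (sym (begin
      sumℚ a ℚ.+ sumℚ a                                 ≡⟨ cong₂ ℚ._+_ (sumℚ-shift l h) (sumℚ-shift l h) ⟩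
      (sumℚ l ℚ.+ N ℚ.* h) ℚ.+ (sumℚ l ℚ.+ N ℚ.* h)
        ≡⟨ solve 3 (λ s n h → (s :+ n :* h) :+ (s :+ n :* h) := (s :+ s) :+ (n :+ n) :* h) refl (sumℚ l) N h ⟩
      (sumℚ l ℚ.+ sumℚ l) ℚ.+ (N ℚ.+ N) ℚ.* h           ≡⟨ cong ((sumℚ l ℚ.+ sumℚ l) ℚ.+_) [N+N]*h≡1 ⟩
      (sumℚ l ℚ.+ sumℚ l) ℚ.+ 1ℚ                        ∎))
      (isInteger-+ (isInteger-+ ∑l-integer ∑l-integer) (+ 1 , refl))
      where open ≡-Reasoning

theorem3p18 : (k : ℕ) (G : SimpleGraph (suc k)) →
  Connected G →
  Reflexive (laplacianSimplex G) →
  let n = suc k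
      Ln = deleteCol (laplacian (whiskeredAdj G)) (fromℕ k ↑ˡ n)
      M = appendOnes Ln
  in ∀ (y : Point (n + n)) →
     (IsLatticePoint y × InFundPar Ln y)
     ⇔ Σ (Fin n → ℚ) (λ μ → InΛ (laplacianSimplex G) μ ×
         ((∀ j → y j ≡ vecMat (dup μ) M j)
          ⊎ (∀ j → y j ≡ vecMat (λ u → dup μ u +ℚ (+ 1 / (n + n))) M j)))
theorem3p18 k G _ reflexive y = mk⇔ (fundPar⇒InDoubledΛ y) (InDoubledΛ⇒fundPar y)
  where
  open ZeroColumnSums (laplacianSimplex G) (laplacianSimplex-columnSum≡0 G) (laplacianSimplex-symmetric G)
  open WhiskeredLatticePoints G (reflexive⇒isInteger[∑a-n*aᵢ] reflexive)
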